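{- For every integer $n \geq 9$, the number of partitions of $n$ into odd parts each greater than or equal to $5$ equals the number of partitions of $n$ such that: the parts greater than $1$ are pairwise distinct; there are at least three parts greater than or equal to $2$; the part $1$ occurs at most twice (it may occur zero, one or two times); and the three largest parts are consecutive integers. -}

module Defs where

open import Data.Bool using (Bool; true; false; _∧_; if_then_else_)
open import Data.Nat using (ℕ; suc; _≤ᵇ_; _≡ᵇ_; _<ᵇ_; _%_)
open import Data.List using (List; []; _∷_; length)
open import Data.Nat.ListAction using (sum)

-- Partitions of n are represented as lists of positive integers in
-- non-increasing order whose sum is n (so each partition has exactly one
-- representation).  All predicates are Bool-valued, so the subtypes
-- Σ (List ℕ) (λ l → T (…)) contain at most one element per list.

allOf : (ℕ → Bool) → List ℕ → Bool
allOf p [] = true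
allOf p (x ∷ xs) = p x ∧ allOf p xs

keep : (ℕ → Bool) → List ℕ → List ℕ
keep p [] = []
keep p (x ∷ xs) = if p x then x ∷ keep p xs else keep p xs

nonIncreasing : List ℕ → Bool
nonIncreasing [] = true
nonIncreasing (x ∷ []) = true
nonIncreasing (x ∷ y ∷ r) = (y ≤ᵇ x) ∧ nonIncreasing (y ∷ r)

strictlyDecreasing : List ℕ → Bool
strictlyDecreasing [] = true
strictlyDecreasing (x ∷ []) = true
strictlyDecreasing (x ∷ y ∷ r) = (y <ᵇ x) ∧ strictlyDecreasing (y ∷ r)

isPartitionOf : ℕ → List ℕ → Bool
isPartitionOf n l = nonIncreasing l ∧ (allOf (λ x → 1 ≤ᵇ x) l ∧ (sum l ≡ᵇ n))

isOdd : ℕ → Bool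
isOdd x = x % 2 ≡ᵇ 1

oddPartsAtLeast5 : List ℕ → Bool
oddPartsAtLeast5 l = allOf (λ x → isOdd x ∧ (5 ≤ᵇ x)) l

-- for a non-increasing list: the first three parts (the three largest)
-- are consecutive integers
threeLargestConsecutive : List ℕ → Bool
threeLargestConsecutive (a ∷ b ∷ c ∷ _) = (a ≡ᵇ suc b) ∧ (b ≡ᵇ suc c)
threeLargestConsecutive _ = false

secondCondition : List ℕ → Bool
secondCondition l =
  strictlyDecreasing (keep (λ x → 2 ≤ᵇ x) l)
  ∧ ((3 ≤ᵇ length (keep (λ x → 2 ≤ᵇ x) l))
  ∧ ((length (keep (λ x → x ≡ᵇ 1) l) ≤ᵇ 2)
  ∧ threeLargestConsecutive l))

-- Generating functions, with power series over ℕ represented by their coefficient sequences.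
-- Both families are enumerated by duplicate-free lists whose lengths are the coefficients of
-- A = ∏_{k≥2} 1/(1 − q^(2k+1)) and B = (1 + q + q²) Σ_{c≥0} q^(9+3c) ∏_{j=2}^{c+1} (1 + q^j).
-- Multiplying A by 1/((1 − q)(1 − q³)) gives all partitions into odd parts, so by Euler's theorem
-- A/((1 − q)(1 − q³)) = (1 + q) D with D = ∏_{j≥2} (1 + q^j). Expanding D by its three largest parts,
-- whose gaps contribute 1/((1 − q)(1 − q²)), and multiplying by 1 + q turns the right-hand side
-- into (1 + q⁵ + q⁷ + B)/((1 − q)(1 − q³)); hence A = 1 + q⁵ + q⁷ + B.

module Submission where

open import Defs
open import Data.Bool using (Bool; true; false; T; _∧_; if_then_else_)
open import Data.Bool.Properties using (T-≡; T-∧; T-irrelevant)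
open import Data.Empty using (⊥; ⊥-elim)
open import Data.Fin using (Fin; zero; suc)
open import Data.List using (List; []; _∷_; _++_; map; length; lookup)
open import Data.List.Properties using (length-++; length-map; ++-identityʳ; ∷-injectiveˡ; ∷-injectiveʳ)
open import Data.List.Membership.Propositional using (_∈_; _∉_)
open import Data.List.Membership.Propositional.Properties
  using (∈-++⁺ˡ; ∈-++⁺ʳ; ∈-++⁻; ∈-map⁺; ∈-map⁻; ∈-lookup)
open import Data.List.Membership.Propositional.Properties.WithK using (unique⇒irrelevant)
open import Data.List.Relation.Unary.All using ([])
open import Data.List.Relation.Unary.Any using (here; there; index)
open import Data.List.Relation.Unary.Unique.Propositional using (Unique; []; _∷_)
import Data.List.Relation.Unary.Unique.Propositional.Properties as Unique
open import Data.Nat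
open import Data.Nat.DivMod using ([m+kn]%n≡m%n)
open import Data.Nat.Induction using (<-rec)
open import Data.Nat.ListAction using (sum)
open import Data.Nat.Properties
open import Algebra.Properties.CommutativeSemigroup +-commutativeSemigroup using (interchange)
open import Data.Nat.Tactic.RingSolver using (solve-∀)
open import Data.Product using (Σ; ∃; ∃-syntax; _×_; _,_; proj₁; proj₂)
open import Data.Product.Function.Dependent.Propositional using (Σ-↔)
open import Data.Sum using (_⊎_; inj₁; inj₂)
open import Data.Unit using (⊤; tt)
open import Function.Base using (_∘_)
open import Function.Bundles using (_↔_; _⇔_; mk↔ₛ′; mk⇔; Equivalence)
open import Function.Construct.Composition using (_↔-∘_; _⇔-∘_)
open import Function.Construct.Identity using (↔-id)
open import Function.Construct.Symmetry using (↔-sym; ⇔-sym)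
open import Relation.Binary.PropositionalEquality
open import Relation.Nullary.Irrelevant using (Irrelevant)
import Relation.Unary as Unary

-- Power series over ℕ

∑< : ℕ → (ℕ → ℕ) → ℕ
∑< zero f = 0
∑< (suc N) f = ∑< N f + f N

syntax ∑< N (λ j → e) = ∑[ j < N ] e

∑-cong : ∀ N {f g : ℕ → ℕ} → (∀ i → i < N → f i ≡ g i) → ∑< N f ≡ ∑< N g
∑-cong zero h = refl
∑-cong (suc N) h = cong₂ _+_ (∑-cong N (λ i i<N → h i (m≤n⇒m≤1+n i<N))) (h N ≤-refl)

∑-distrib-+ : ∀ N (f g : ℕ → ℕ) → ∑[ i < N ] (f i + g i) ≡ ∑< N f + ∑< N g
∑-distrib-+ zero f g = refl
∑-distrib-+ (suc N) f g =
  trans (cong (_+ (f N + g N)) (∑-distrib-+ N f g)) (interchange (∑< N f) (∑< N g) (f N) (g N))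

∑-head : ∀ N (f : ℕ → ℕ) → ∑< (suc N) f ≡ f 0 + ∑[ i < N ] f (suc i)
∑-head zero f = +-comm 0 (f 0)
∑-head (suc N) f = trans (cong (_+ f (suc N)) (∑-head N f)) (+-assoc (f 0) _ _)

∑-extend : ∀ N M (f : ℕ → ℕ) → N ≤ M → (∀ i → N ≤ i → f i ≡ 0) → ∑< M f ≡ ∑< N f
∑-extend .zero zero f z≤n _ = refl
∑-extend N (suc M) f N≤1+M vanish with m≤n⇒m<n∨m≡n N≤1+M
... | inj₂ refl = refl
... | inj₁ N<1+M =
  trans (cong₂ _+_ (∑-extend N M f (≤-pred N<1+M) vanish) (vanish M (≤-pred N<1+M))) (+-identityʳ _)

∑-triangle : ∀ N (h : ℕ → ℕ → ℕ) →
  ∑[ a < N ] ∑[ b < a ] h a b ≡ ∑[ b < N ] ∑[ j < N ∸ suc b ] h (suc b + j) b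
∑-triangle zero h = refl
∑-triangle (suc N) h = begin
  ∑[ a < N ] ∑[ b < a ] h a b + ∑[ b < N ] h N b   ≡⟨ cong (_+ ∑[ b < N ] h N b) (∑-triangle N h) ⟩
  ∑[ b < N ] R N b + ∑[ b < N ] h N b               ≡⟨ ∑-distrib-+ N _ _ ⟨
  ∑[ b < N ] (R N b + h N b)                        ≡⟨ ∑-cong N (λ b b<N → sym (R-suc b b<N)) ⟩
  ∑[ b < N ] R (suc N) b                            ≡⟨ +-identityʳ _ ⟨
  ∑[ b < N ] R (suc N) b + 0                        ≡⟨ cong (∑[ b < N ] R (suc N) b +_) R-last ⟨
  ∑[ b < suc N ] R (suc N) b                        ∎
  where
  open ≡-Reasoning
  R : ℕ → ℕ → ℕ
  R M b = ∑[ j < M ∸ suc b ] h (suc b + j) b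
  R-last : R (suc N) N ≡ 0
  R-last = cong (λ m → ∑< m (λ j → h (suc N + j) N)) (n∸n≡0 N)
  R-suc : ∀ b → b < N → R (suc N) b ≡ R N b + h N b
  R-suc b b<N = trans (cong (λ m → ∑< m (λ j → h (suc b + j) b)) (+-∸-assoc 1 b<N))
    (cong (R N b +_) (cong (λ a → h a b) (m+[n∸m]≡n b<N)))

Series : Set
Series = ℕ → ℕ

one : Series
one zero = 1
one (suc n) = 0

infixl 6 _⊕_
_⊕_ : Series → Series → Series
(X ⊕ Y) n = X n + Y n

⊕-cong : ∀ {X X′ Y Y′} → X ≗ X′ → Y ≗ Y′ → X ⊕ Y ≗ X′ ⊕ Y′
⊕-cong p q n = cong₂ _+_ (p n) (q n)

∑ˢ : ℕ → (ℕ → Series) → Series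
∑ˢ N F n = ∑[ j < N ] F j n

syntax ∑ˢ N (λ j → e) = ∑ˢ[ j < N ] e

infixr 7 q^_·_
q^_·_ : ℕ → Series → Series
(q^ zero · X) n = X n
(q^ suc m · X) zero = 0
(q^ suc m · X) (suc n) = (q^ m · X) n

shift-cong : ∀ m {X Y} → X ≗ Y → q^ m · X ≗ q^ m · Y
shift-cong zero p n = p n
shift-cong (suc m) p zero = refl
shift-cong (suc m) p (suc n) = shift-cong m p n

shift-⊕ : ∀ m X Y → q^ m · (X ⊕ Y) ≗ q^ m · X ⊕ q^ m · Y
shift-⊕ zero X Y n = refl
shift-⊕ (suc m) X Y zero = refl
shift-⊕ (suc m) X Y (suc n) = shift-⊕ m X Y n

shift-shift : ∀ a b X → q^ a · q^ b · X ≗ q^ (a + b) · X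
shift-shift zero b X n = refl
shift-shift (suc a) b X zero = refl
shift-shift (suc a) b X (suc n) = shift-shift a b X n

shift-comm : ∀ a b X → q^ a · q^ b · X ≗ q^ b · q^ a · X
shift-comm a b X n = begin
  (q^ a · q^ b · X) n   ≡⟨ shift-shift a b X n ⟩
  (q^ (a + b) · X) n    ≡⟨ cong (λ e → (q^ e · X) n) (+-comm a b) ⟩
  (q^ (b + a) · X) n    ≡⟨ shift-shift b a X n ⟨
  (q^ b · q^ a · X) n   ∎
  where open ≡-Reasoning

shift-unfold : ∀ {X Y Z} c a → X ≗ Y ⊕ q^ c · Z → ∀ n → (q^ a · X) n ≡ (q^ a · Y) n + (q^ (a + c) · Z) n
shift-unfold {Y = Y} c a fix n =
  trans (shift-cong a fix n) (trans (shift-⊕ a _ _ n) (cong ((q^ a · Y) n +_) (shift-shift a c _ n)))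

shift-vanishes : ∀ m X n → n < m → (q^ m · X) n ≡ 0
shift-vanishes (suc m) X zero _ = refl
shift-vanishes (suc m) X (suc n) n<m = shift-vanishes m X n (≤-pred n<m)

shift-≥ : ∀ m X n → m ≤ n → (q^ m · X) n ≡ X (n ∸ m)
shift-≥ zero X n _ = refl
shift-≥ (suc m) X (suc n) m≤n = shift-≥ m X n (≤-pred m≤n)

if-≤ᵇ-shift : ∀ m s (X : Series) {a} → a ≡ X (s ∸ m) → (if m ≤ᵇ s then a else 0) ≡ (q^ m · X) s
if-≤ᵇ-shift m s X a≡ with m ≤ᵇ s in m≤ᵇs
... | true = trans a≡ (sym (shift-≥ m X s (≤ᵇ⇒≤ m s (subst T (sym m≤ᵇs) _))))
... | false = sym (shift-vanishes m X s (≰⇒> (λ m≤s → subst T m≤ᵇs (≤⇒≤ᵇ m≤s))))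

shift-local : ∀ m {X Y} n → (∀ i → m + i ≤ n → X i ≡ Y i) → (q^ m · X) n ≡ (q^ m · Y) n
shift-local zero n agree = agree n ≤-refl
shift-local (suc m) zero agree = refl
shift-local (suc m) (suc n) agree = shift-local m n (λ i m+i≤n → agree i (s≤s m+i≤n))

shift-local-≤ : ∀ m {X Y} n → (∀ i → i ≤ n → X i ≡ Y i) → (q^ m · X) n ≡ (q^ m · Y) n
shift-local-≤ m n agree = shift-local m n (λ i m+i≤n → agree i (≤-trans (m≤n+m i m) m+i≤n))

shift-local-< : ∀ m {X Y} n → (∀ i → i < n → X i ≡ Y i) → (q^ suc m · X) n ≡ (q^ suc m · Y) n
shift-local-< m n agree = shift-local (suc m) n (λ i m+i<n → agree i (≤-trans (s≤s (m≤n+m i m)) m+i<n))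

shift-∑ : ∀ m N F → q^ m · ∑ˢ N F ≗ ∑ˢ[ j < N ] (q^ m · F j)
shift-∑ m zero F n = shift-vanishes-zero m n
  where
  shift-vanishes-zero : ∀ m n → (q^ m · ∑ˢ 0 F) n ≡ 0
  shift-vanishes-zero zero n = refl
  shift-vanishes-zero (suc m) zero = refl
  shift-vanishes-zero (suc m) (suc n) = shift-vanishes-zero m n
shift-∑ m (suc N) F n = trans (shift-⊕ m (∑ˢ N F) (F N) n) (cong (_+ (q^ m · F N) n) (shift-∑ m N F n))

infixl 7 _/[1-q^1+_]
_/[1-q^1+_] : Series → ℕ → Series
(X /[1-q^1+ k ]) n = ∑[ j < suc n ] (q^ (suc k * j) · X) n

geom-sum : ∀ k X K n → n < K → ∑[ j < K ] (q^ (suc k * j) · X) n ≡ (X /[1-q^1+ k ]) n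
geom-sum k X K n n<K = ∑-extend (suc n) K _ n<K
  (λ j n<j → shift-vanishes (suc k * j) X n (≤-trans n<j (m≤n*m j (suc k))))

shift-geom-sum : ∀ k X s K n → n < s + K → ∑[ j < K ] (q^ (s + suc k * j) · X) n ≡ (q^ s · (X /[1-q^1+ k ])) n
shift-geom-sum k X s K n n<s+K = begin
  ∑[ j < K ] (q^ (s + suc k * j) · X) n        ≡⟨ ∑-cong K (λ j _ → shift-shift s (suc k * j) X n) ⟨
  ∑[ j < K ] (q^ s · q^ (suc k * j) · X) n     ≡⟨ shift-∑ s K _ n ⟨
  (q^ s · ∑ˢ[ j < K ] (q^ (suc k * j) · X)) n  ≡⟨ shift-local s n (λ i → geom-sum k X K i ∘ i<K) ⟩
  (q^ s · (X /[1-q^1+ k ])) n                  ∎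
  where
  open ≡-Reasoning
  i<K : ∀ {i} → s + i ≤ n → i < K
  i<K s+i≤n = +-cancelˡ-< s _ K (≤-<-trans s+i≤n n<s+K)

geom-fix : ∀ k X → X /[1-q^1+ k ] ≗ X ⊕ q^ suc k · (X /[1-q^1+ k ])
geom-fix k X n = begin
  ∑[ j < suc n ] (q^ (suc k * j) · X) n
    ≡⟨ ∑-head n _ ⟩
  (q^ (suc k * 0) · X) n + ∑[ j < n ] (q^ (suc k * suc j) · X) n
    ≡⟨ cong₂ _+_ (cong (λ e → (q^ e · X) n) (*-zeroʳ (suc k))) (∑-cong n (λ j _ → peel j)) ⟩
  X n + ∑[ j < n ] (q^ suc k · q^ (suc k * j) · X) n
    ≡⟨ cong (X n +_) (shift-∑ (suc k) n _ n) ⟨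
  X n + (q^ suc k · ∑ˢ[ j < n ] (q^ (suc k * j) · X)) n
    ≡⟨ cong (X n +_) (shift-local-< k n (geom-sum k X n)) ⟩
  X n + (q^ suc k · (X /[1-q^1+ k ])) n ∎
  where
  open ≡-Reasoning
  peel : ∀ j → (q^ (suc k * suc j) · X) n ≡ (q^ suc k · q^ (suc k * j) · X) n
  peel j = trans (cong (λ e → (q^ e · X) n) (*-suc (suc k) j)) (sym (shift-shift (suc k) (suc k * j) X n))

geom-unique : ∀ k {X Y} → Y ≗ X ⊕ q^ suc k · Y → Y ≗ X /[1-q^1+ k ]
geom-unique k {X} {Y} fix = <-rec _ step
  where
  step : ∀ n → (∀ {i} → i < n → Y i ≡ (X /[1-q^1+ k ]) i) → Y n ≡ (X /[1-q^1+ k ]) n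
  step n ih = trans (fix n) (trans (cong (X n +_) (shift-local-< k n (λ i → ih))) (sym (geom-fix k X n)))

geom-cong : ∀ k {X X′} → X ≗ X′ → X /[1-q^1+ k ] ≗ X′ /[1-q^1+ k ]
geom-cong k {X} p = geom-unique k (λ n → trans (geom-fix k X n) (cong (_+ _) (p n)))

geom-⊕ : ∀ k X Y → (X ⊕ Y) /[1-q^1+ k ] ≗ X /[1-q^1+ k ] ⊕ Y /[1-q^1+ k ]
geom-⊕ k X Y = λ n → sym (geom-unique k fix n)
  where
  fix : X /[1-q^1+ k ] ⊕ Y /[1-q^1+ k ] ≗ (X ⊕ Y) ⊕ q^ suc k · (X /[1-q^1+ k ] ⊕ Y /[1-q^1+ k ])
  fix n = trans (cong₂ _+_ (geom-fix k X n) (geom-fix k Y n))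
    (trans (interchange (X n) _ (Y n) _) (cong (X n + Y n +_) (sym (shift-⊕ (suc k) _ _ n))))

geom-shift : ∀ k m X → (q^ m · X) /[1-q^1+ k ] ≗ q^ m · (X /[1-q^1+ k ])
geom-shift k m X = λ n → sym (geom-unique k fix n)
  where
  fix : q^ m · (X /[1-q^1+ k ]) ≗ q^ m · X ⊕ q^ suc k · q^ m · (X /[1-q^1+ k ])
  fix n = trans (shift-cong m (geom-fix k X) n)
    (trans (shift-⊕ m X _ n) (cong ((q^ m · X) n +_) (shift-comm m (suc k) _ n)))

geom-comm : ∀ k j X → X /[1-q^1+ j ] /[1-q^1+ k ] ≗ X /[1-q^1+ k ] /[1-q^1+ j ]
geom-comm k j X = geom-unique j λ n →
  trans (geom-cong k (geom-fix j X) n)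
    (trans (geom-⊕ k X _ n) (cong ((X /[1-q^1+ k ]) n +_) (geom-shift k (suc j) _ n)))

geom-∑ : ∀ k N F → ∑ˢ N F /[1-q^1+ k ] ≗ ∑ˢ[ j < N ] (F j /[1-q^1+ k ])
geom-∑ k zero F = λ n → sym (geom-unique k (λ n → sym (shift-∑ (suc k) 0 F n)) n)
geom-∑ k (suc N) F n = trans (geom-⊕ k (∑ˢ N F) (F N) n) (cong (_+ (F N /[1-q^1+ k ]) n) (geom-∑ k N F n))

geom-small : ∀ k X n → n ≤ k → (X /[1-q^1+ k ]) n ≡ X n
geom-small k X n n≤k =
  trans (geom-fix k X n) (trans (cong (X n +_) (shift-vanishes (suc k) _ n (s≤s n≤k))) (+-identityʳ _))

geom-local : ∀ k {X Y} n → (∀ i → i ≤ n → X i ≡ Y i) → (X /[1-q^1+ k ]) n ≡ (Y /[1-q^1+ k ]) n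
geom-local k n agree = ∑-cong (suc n) (λ j _ → shift-local-≤ (suc k * j) n agree)

geom-injective-upTo : ∀ k {X Y} n → (∀ i → i ≤ n → (X /[1-q^1+ k ]) i ≡ (Y /[1-q^1+ k ]) i) → X n ≡ Y n
geom-injective-upTo k {X} {Y} n agree = +-cancelʳ-≡ _ (X n) (Y n) (begin
  X n + (q^ suc k · (X /[1-q^1+ k ])) n   ≡⟨ geom-fix k X n ⟨
  (X /[1-q^1+ k ]) n                      ≡⟨ agree n ≤-refl ⟩
  (Y /[1-q^1+ k ]) n                      ≡⟨ geom-fix k Y n ⟩
  Y n + (q^ suc k · (Y /[1-q^1+ k ])) n
    ≡⟨ cong (Y n +_) (shift-local-< k n (λ i i<n → sym (agree i (<⇒≤ i<n)))) ⟩
  Y n + (q^ suc k · (X /[1-q^1+ k ])) n   ∎)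
  where open ≡-Reasoning

geom-injective : ∀ k {X Y} → X /[1-q^1+ k ] ≗ Y /[1-q^1+ k ] → X ≗ Y
geom-injective k p n = geom-injective-upTo k n (λ i _ → p i)

infixl 7 _*[1+q^_] _*[1+q+q²]
_*[1+q^_] : Series → ℕ → Series
X *[1+q^ m ] = X ⊕ q^ m · X

_*[1+q+q²] : Series → Series
X *[1+q+q²] = X ⊕ q^ 1 · X ⊕ q^ 2 · X

*[1+q^]-cong : ∀ m {X Y} → X ≗ Y → X *[1+q^ m ] ≗ Y *[1+q^ m ]
*[1+q^]-cong m p = ⊕-cong p (shift-cong m p)

*[1+q^]-local : ∀ m {X Y} n → (∀ i → i ≤ n → X i ≡ Y i) → (X *[1+q^ m ]) n ≡ (Y *[1+q^ m ]) n
*[1+q^]-local m n agree = cong₂ _+_ (agree n ≤-refl) (shift-local-≤ m n agree)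

*[1+q^]-⊕ : ∀ m X Y → (X ⊕ Y) *[1+q^ m ] ≗ X *[1+q^ m ] ⊕ Y *[1+q^ m ]
*[1+q^]-⊕ m X Y n = trans (cong ((X n + Y n) +_) (shift-⊕ m X Y n)) (interchange (X n) (Y n) _ _)

*[1+q^]-comm : ∀ a b X → X *[1+q^ b ] *[1+q^ a ] ≗ X *[1+q^ a ] *[1+q^ b ]
*[1+q^]-comm a b X n = begin
  (X n + (q^ b · X) n) + (q^ a · (X ⊕ q^ b · X)) n
    ≡⟨ cong ((X n + (q^ b · X) n) +_) (shift-⊕ a X _ n) ⟩
  (X n + (q^ b · X) n) + ((q^ a · X) n + (q^ a · q^ b · X) n)
    ≡⟨ interchange (X n) _ _ _ ⟩
  (X n + (q^ a · X) n) + ((q^ b · X) n + (q^ a · q^ b · X) n)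
    ≡⟨ cong (λ z → (X n + (q^ a · X) n) + ((q^ b · X) n + z)) (shift-comm a b X n) ⟩
  (X n + (q^ a · X) n) + ((q^ b · X) n + (q^ b · q^ a · X) n)
    ≡⟨ cong ((X n + (q^ a · X) n) +_) (shift-⊕ b X _ n) ⟨
  (X n + (q^ a · X) n) + (q^ b · (X ⊕ q^ a · X)) n ∎
  where open ≡-Reasoning

geom-*[1+q^] : ∀ k m X → X *[1+q^ m ] /[1-q^1+ k ] ≗ X /[1-q^1+ k ] *[1+q^ m ]
geom-*[1+q^] k m X n = trans (geom-⊕ k X (q^ m · X) n) (cong (_ +_) (geom-shift k m X n))

[1+q^m]/[1-q^2m] : ∀ k X → X *[1+q^ suc k ] /[1-q^1+ k + suc k ] ≗ X /[1-q^1+ k ]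
[1+q^m]/[1-q^2m] k X n = sym (geom-unique (k + suc k) fix n)
  where
  G = X /[1-q^1+ k ]
  fix : G ≗ X *[1+q^ suc k ] ⊕ q^ suc (k + suc k) · G
  fix n = begin
    G n                                                   ≡⟨ geom-fix k X n ⟩
    X n + (q^ suc k · G) n
      ≡⟨ cong (X n +_) (shift-unfold (suc k) (suc k) (geom-fix k X) n) ⟩
    X n + ((q^ suc k · X) n + (q^ (suc k + suc k) · G) n) ≡⟨ +-assoc (X n) _ _ ⟨
    (X n + (q^ suc k · X) n) + (q^ (suc k + suc k) · G) n ∎
    where open ≡-Reasoning

[1+q+q²]/[1-q³] : ∀ X → X *[1+q+q²] /[1-q^1+ 2 ] ≗ X /[1-q^1+ 0 ]
[1+q+q²]/[1-q³] X n = sym (geom-unique 2 fix n)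
  where
  G = X /[1-q^1+ 0 ]
  unfold : ∀ a n → (q^ a · G) n ≡ (q^ a · X) n + (q^ (a + 1) · G) n
  unfold a = shift-unfold 1 a (geom-fix 0 X)
  fix : G ≗ X *[1+q+q²] ⊕ q^ 3 · G
  fix n = begin
    G n                                                   ≡⟨ unfold 0 n ⟩
    X n + (q^ 1 · G) n                                    ≡⟨ cong (X n +_) (unfold 1 n) ⟩
    X n + ((q^ 1 · X) n + (q^ 2 · G) n)                   ≡⟨ cong (λ z → X n + ((q^ 1 · X) n + z)) (unfold 2 n) ⟩
    X n + ((q^ 1 · X) n + ((q^ 2 · X) n + (q^ 3 · G) n)) ≡⟨ reassoc (X n) _ _ _ ⟩
    ((X n + (q^ 1 · X) n) + (q^ 2 · X) n) + (q^ 3 · G) n ∎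
    where
    open ≡-Reasoning
    reassoc : ∀ a b c d → a + (b + (c + d)) ≡ ((a + b) + c) + d
    reassoc a b c d = trans (sym (+-assoc a b (c + d))) (sym (+-assoc (a + b) c d))

*[1+q+q²]-local : ∀ {X Y} n → (∀ i → i ≤ n → X i ≡ Y i) → (X *[1+q+q²]) n ≡ (Y *[1+q+q²]) n
*[1+q+q²]-local n agree =
  cong₂ _+_ (cong₂ _+_ (agree n ≤-refl) (shift-local-≤ 1 n agree)) (shift-local-≤ 2 n agree)

shift-*[1+q+q²] : ∀ a X → q^ a · (X *[1+q+q²]) ≗ (q^ a · X) *[1+q+q²]
shift-*[1+q+q²] a X n = trans (shift-⊕ a _ _ n)
  (cong₂ _+_ (trans (shift-⊕ a X _ n) (cong ((q^ a · X) n +_) (shift-comm a 1 X n))) (shift-comm a 2 X n))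

∑-*[1+q+q²] : ∀ N F → ∑ˢ N F *[1+q+q²] ≗ ∑ˢ[ j < N ] (F j *[1+q+q²])
∑-*[1+q+q²] N F n = begin
  (∑ˢ N F n + (q^ 1 · ∑ˢ N F) n) + (q^ 2 · ∑ˢ N F) n
    ≡⟨ cong₂ (λ u v → (∑ˢ N F n + u) + v) (shift-∑ 1 N F n) (shift-∑ 2 N F n) ⟩
  (∑ˢ N F n + ∑[ j < N ] (q^ 1 · F j) n) + ∑[ j < N ] (q^ 2 · F j) n
    ≡⟨ cong (_+ ∑[ j < N ] (q^ 2 · F j) n) (∑-distrib-+ N _ _) ⟨
  ∑[ j < N ] (F j n + (q^ 1 · F j) n) + ∑[ j < N ] (q^ 2 · F j) n
    ≡⟨ ∑-distrib-+ N _ _ ⟨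
  ∑[ j < N ] (F j *[1+q+q²]) n ∎
  where open ≡-Reasoning

*[1+q+q²]-*[1+q^] : ∀ m X → X *[1+q^ m ] *[1+q+q²] ≗ X *[1+q+q²] *[1+q^ m ]
*[1+q+q²]-*[1+q^] m X n = begin
  (Y n + (q^ 1 · Y) n) + (q^ 2 · Y) n
    ≡⟨ cong₂ (λ u v → (Y n + u) + v) (swapped 1) (swapped 2) ⟩
  ((X n + M n) + ((q^ 1 · X) n + (q^ 1 · M) n)) + ((q^ 2 · X) n + (q^ 2 · M) n)
    ≡⟨ cong (_+ ((q^ 2 · X) n + (q^ 2 · M) n)) (interchange (X n) (M n) _ _) ⟩
  ((X n + (q^ 1 · X) n) + (M n + (q^ 1 · M) n)) + ((q^ 2 · X) n + (q^ 2 · M) n)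
    ≡⟨ interchange (X n + (q^ 1 · X) n) _ _ _ ⟩
  (X *[1+q+q²]) n + ((M n + (q^ 1 · M) n) + (q^ 2 · M) n)
    ≡⟨ cong ((X *[1+q+q²]) n +_) (shift-*[1+q+q²] m X n) ⟨
  (X *[1+q+q²] *[1+q^ m ]) n ∎
  where
  open ≡-Reasoning
  Y = X *[1+q^ m ]
  M = q^ m · X
  swapped : ∀ a → (q^ a · Y) n ≡ (q^ a · X) n + (q^ a · M) n
  swapped a = shift-⊕ a X M n

-- Euler's theorem

distinctParts : ℕ → Series
distinctParts zero = one
distinctParts (suc m) = distinctParts m *[1+q^ suc m ]

oddParts : ℕ → Series
oddParts zero = one
oddParts (suc m) = oddParts m /[1-q^1+ m + m ]

allParts : ℕ → Series
allParts zero = one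
allParts (suc m) = allParts m /[1-q^1+ m ]

infixl 7 _/∏[1-q^2j]_
_/∏[1-q^2j]_ : Series → ℕ → Series
X /∏[1-q^2j] zero = X
X /∏[1-q^2j] suc m = X /∏[1-q^2j] m /[1-q^1+ m + suc m ]

∏[1-q^2j]-*[1+q^] : ∀ m a X → X *[1+q^ a ] /∏[1-q^2j] m ≗ X /∏[1-q^2j] m *[1+q^ a ]
∏[1-q^2j]-*[1+q^] zero a X n = refl
∏[1-q^2j]-*[1+q^] (suc m) a X n =
  trans (geom-cong (m + suc m) (∏[1-q^2j]-*[1+q^] m a X) n) (geom-*[1+q^] (m + suc m) a _ n)

∏[1-q^2j]-geom : ∀ m k X → X /[1-q^1+ k ] /∏[1-q^2j] m ≗ X /∏[1-q^2j] m /[1-q^1+ k ]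
∏[1-q^2j]-geom zero k X n = refl
∏[1-q^2j]-geom (suc m) k X n =
  trans (geom-cong (m + suc m) (∏[1-q^2j]-geom m k X) n) (geom-comm (m + suc m) k _ n)

∏[1-q^2j]-injective-upTo : ∀ m {X Y} n →
  (∀ i → i ≤ n → (X /∏[1-q^2j] m) i ≡ (Y /∏[1-q^2j] m) i) → X n ≡ Y n
∏[1-q^2j]-injective-upTo zero n agree = agree n ≤-refl
∏[1-q^2j]-injective-upTo (suc m) n agree = ∏[1-q^2j]-injective-upTo m n
  (λ i i≤n → geom-injective-upTo (m + suc m) i (λ j j≤i → agree j (≤-trans j≤i i≤n)))

distinctParts/∏[1-q^2j] : ∀ m → distinctParts m /∏[1-q^2j] m ≗ allParts m
distinctParts/∏[1-q^2j] zero n = refl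
distinctParts/∏[1-q^2j] (suc m) n = begin
  (distinctParts m *[1+q^ suc m ] /∏[1-q^2j] m /[1-q^1+ m + suc m ]) n
    ≡⟨ geom-cong (m + suc m) (∏[1-q^2j]-*[1+q^] m (suc m) _) n ⟩
  (distinctParts m /∏[1-q^2j] m *[1+q^ suc m ] /[1-q^1+ m + suc m ]) n
    ≡⟨ geom-cong (m + suc m) (*[1+q^]-cong (suc m) (distinctParts/∏[1-q^2j] m)) n ⟩
  (allParts m *[1+q^ suc m ] /[1-q^1+ m + suc m ]) n
    ≡⟨ [1+q^m]/[1-q^2m] m (allParts m) n ⟩
  allParts (suc m) n ∎
  where open ≡-Reasoning

oddParts/∏[1-q^2j] : ∀ m → oddParts m /∏[1-q^2j] m ≗ allParts (m + m)
oddParts/∏[1-q^2j] zero n = refl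
oddParts/∏[1-q^2j] (suc m) n = begin
  (oddParts m /[1-q^1+ m + m ] /∏[1-q^2j] m /[1-q^1+ m + suc m ]) n
    ≡⟨ geom-cong (m + suc m) (∏[1-q^2j]-geom m (m + m) _) n ⟩
  (oddParts m /∏[1-q^2j] m /[1-q^1+ m + m ] /[1-q^1+ m + suc m ]) n
    ≡⟨ geom-cong (m + suc m) (geom-cong (m + m) (oddParts/∏[1-q^2j] m)) n ⟩
  (allParts (suc (m + m)) /[1-q^1+ m + suc m ]) n
    ≡⟨ cong (λ k → (allParts (suc (m + m)) /[1-q^1+ k ]) n) (+-suc m m) ⟩
  allParts (suc (suc (m + m))) n
    ≡⟨ cong (λ k → allParts (suc k) n) (+-suc m m) ⟨
  allParts (suc m + suc m) n ∎
  where open ≡-Reasoning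

allParts-stable : ∀ m j n → n ≤ m → allParts (m + j) n ≡ allParts m n
allParts-stable m zero n _ = cong (λ k → allParts k n) (+-identityʳ m)
allParts-stable m (suc j) n n≤m = begin
  allParts (m + suc j) n             ≡⟨ cong (λ k → allParts k n) (+-suc m j) ⟩
  (allParts (m + j) /[1-q^1+ m + j ]) n ≡⟨ geom-small (m + j) _ n (≤-trans n≤m (m≤m+n m j)) ⟩
  allParts (m + j) n                 ≡⟨ allParts-stable m j n n≤m ⟩
  allParts m n                       ∎
  where open ≡-Reasoning

-- Dividing by ∏_{j≤m} (1 − q^(2j)) turns both sides into ∏ 1/(1 − q^i), over i ≤ 2m and i ≤ m
-- respectively, and these agree up to degree m.
euler : ∀ m n → n ≤ m → oddParts m n ≡ distinctParts m n
euler m n n≤m = ∏[1-q^2j]-injective-upTo m n λ i i≤n → begin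
  (oddParts m /∏[1-q^2j] m) i      ≡⟨ oddParts/∏[1-q^2j] m i ⟩
  allParts (m + m) i               ≡⟨ allParts-stable m m i (≤-trans i≤n n≤m) ⟩
  allParts m i                     ≡⟨ distinctParts/∏[1-q^2j] m i ⟨
  (distinctParts m /∏[1-q^2j] m) i ∎
  where open ≡-Reasoning

-- The generating-function identity

ProductFrom2 : (ℕ → Series) → Set
ProductFrom2 Y = ∀ a → Y (suc a) ≗ Y a *[1+q^ 2 + a ]

productFrom2-expand : ∀ {Y} → ProductFrom2 Y → ∀ a → Y a ≗ Y 0 ⊕ ∑ˢ[ b < a ] (q^ (2 + b) · Y b)
productFrom2-expand prod zero n = sym (+-identityʳ _)
productFrom2-expand {Y} prod (suc a) n = begin
  Y (suc a) n
    ≡⟨ prod a n ⟩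
  Y a n + (q^ (2 + a) · Y a) n
    ≡⟨ cong (_+ (q^ (2 + a) · Y a) n) (productFrom2-expand prod a n) ⟩
  (Y 0 n + ∑[ b < a ] (q^ (2 + b) · Y b) n) + (q^ (2 + a) · Y a) n
    ≡⟨ +-assoc (Y 0 n) _ _ ⟩
  Y 0 n + ∑[ b < suc a ] (q^ (2 + b) · Y b) n ∎
  where open ≡-Reasoning

productFrom2-geom : ∀ {Y} k → ProductFrom2 Y → ProductFrom2 (λ a → Y a /[1-q^1+ k ])
productFrom2-geom {Y} k prod a n = trans (geom-cong k (prod a) n) (geom-*[1+q^] k (2 + a) (Y a) n)

-- Expand each Y a by its largest factor q^(2+b); the sum over a > b is then a geometric series.
∑-productFrom2 : ∀ {Y} → ProductFrom2 Y → ∀ s k n →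
  ∑[ a < n ] (q^ (suc s + suc k * a) · Y a) n
  ≡ (q^ suc s · (Y 0 /[1-q^1+ k ])) n
    + ∑[ b < n ] (q^ (suc s + suc k + 2 + suc (suc k) * b) · (Y b /[1-q^1+ k ])) n
∑-productFrom2 {Y} prod s k n = begin
  ∑[ a < n ] (q^ e a · Y a) n
    ≡⟨ ∑-cong n (λ a _ → expand a) ⟩
  ∑[ a < n ] ((q^ e a · Y 0) n + ∑[ b < a ] H a b)
    ≡⟨ ∑-distrib-+ n _ _ ⟩
  ∑[ a < n ] (q^ e a · Y 0) n + ∑[ a < n ] ∑[ b < a ] H a b
    ≡⟨ cong₂ _+_ (shift-geom-sum k (Y 0) (suc s) n n (s≤s (m≤n+m n s))) (∑-triangle n H) ⟩
  (q^ suc s · (Y 0 /[1-q^1+ k ])) n + ∑[ b < n ] ∑[ j < n ∸ suc b ] H (suc b + j) b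
    ≡⟨ cong ((q^ suc s · (Y 0 /[1-q^1+ k ])) n +_) (∑-cong n (λ b _ → largest b)) ⟩
  (q^ suc s · (Y 0 /[1-q^1+ k ])) n + ∑[ b < n ] (q^ e′ b · (Y b /[1-q^1+ k ])) n ∎
  where
  open ≡-Reasoning
  e e′ : ℕ → ℕ
  e a = suc s + suc k * a
  e′ b = suc s + suc k + 2 + suc (suc k) * b
  H : ℕ → ℕ → ℕ
  H a b = (q^ (e a + (2 + b)) · Y b) n
  expand : ∀ a → (q^ e a · Y a) n ≡ (q^ e a · Y 0) n + ∑[ b < a ] H a b
  expand a = trans (shift-cong (e a) (productFrom2-expand prod a) n) (trans (shift-⊕ (e a) (Y 0) _ n)
    (cong ((q^ e a · Y 0) n +_)
      (trans (shift-∑ (e a) a _ n) (∑-cong a (λ b _ → shift-shift (e a) (2 + b) (Y b) n)))))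
  exponent : ∀ s k b j → (suc s + suc k * (suc b + j)) + (2 + b) ≡ (suc s + suc k + 2 + suc (suc k) * b) + suc k * j
  exponent = solve-∀
  e′-split : ∀ s k b → suc s + suc k + 2 + suc (suc k) * b ≡ (2 + b) + (suc s + suc k + suc k * b)
  e′-split = solve-∀
  gap : ∀ b → n < e′ b + (n ∸ suc b)
  gap b = ≤-trans (s≤s (m≤n+m∸n n (suc b)))
    (+-monoˡ-≤ (n ∸ suc b) (≤-trans (m≤m+n (2 + b) _) (≤-reflexive (sym (e′-split s k b)))))
  largest : ∀ b → ∑[ j < n ∸ suc b ] H (suc b + j) b ≡ (q^ e′ b · (Y b /[1-q^1+ k ])) n
  largest b = trans (∑-cong (n ∸ suc b) (λ j _ → cong (λ x → (q^ x · Y b) n) (exponent s k b j)))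
    (shift-geom-sum k (Y b) (e′ b) (n ∸ suc b) n (gap b))

distinctFrom2 : ℕ → Series
distinctFrom2 zero = one
distinctFrom2 (suc c) = distinctFrom2 c *[1+q^ 2 + c ]

distinctFrom2-product : ProductFrom2 distinctFrom2
distinctFrom2-product c n = refl

distinctFrom2-stable : ∀ a j i → i < 2 + a → distinctFrom2 (a + j) i ≡ distinctFrom2 a i
distinctFrom2-stable a zero i _ = cong (λ c → distinctFrom2 c i) (+-identityʳ a)
distinctFrom2-stable a (suc j) i i<2+a = begin
  distinctFrom2 (a + suc j) i
    ≡⟨ cong (λ c → distinctFrom2 c i) (+-suc a j) ⟩
  distinctFrom2 (a + j) i + (q^ (2 + (a + j)) · distinctFrom2 (a + j)) i
    ≡⟨ cong (distinctFrom2 (a + j) i +_) (shift-vanishes (2 + (a + j)) _ i i<2+a+j) ⟩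
  distinctFrom2 (a + j) i + 0
    ≡⟨ +-identityʳ _ ⟩
  distinctFrom2 (a + j) i
    ≡⟨ distinctFrom2-stable a j i i<2+a ⟩
  distinctFrom2 a i ∎
  where
  open ≡-Reasoning
  i<2+a+j = ≤-trans i<2+a (+-monoʳ-≤ 2 (m≤m+n a j))

distinctParts≗distinctFrom2*[1+q] : ∀ m → distinctParts (suc m) ≗ distinctFrom2 m *[1+q^ 1 ]
distinctParts≗distinctFrom2*[1+q] zero n = refl
distinctParts≗distinctFrom2*[1+q] (suc m) n = trans (*[1+q^]-cong (2 + m) (distinctParts≗distinctFrom2*[1+q] m) n)
  (*[1+q^]-comm (2 + m) 1 (distinctFrom2 m) n)

distinctFrom2∞ : Series
distinctFrom2∞ n = distinctFrom2 n n

-- q^(9+3c) is the weight of the three largest parts c + 4, c + 3, c + 2.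
topTriples : (ℕ → Series) → Series
topTriples Z n = ∑[ c < n ] (q^ (9 + 3 * c) · Z c) n

topTriples-truncate : ∀ Z N i → i ≤ N → ∑[ c < N ] (q^ (9 + 3 * c) · Z c) i ≡ topTriples Z i
topTriples-truncate Z N i i≤N = ∑-extend i N _ i≤N λ c i≤c →
  shift-vanishes (9 + 3 * c) (Z c) i (s≤s (≤-trans i≤c (≤-trans (m≤n*m c 3) (m≤n+m (3 * c) 8))))

topTriples-geom : ∀ k Z → topTriples (λ c → Z c /[1-q^1+ k ]) ≗ topTriples Z /[1-q^1+ k ]
topTriples-geom k Z n = begin
  ∑[ c < n ] (q^ (9 + 3 * c) · (Z c /[1-q^1+ k ])) n   ≡⟨ ∑-cong n (λ c _ → geom-shift k (9 + 3 * c) (Z c) n) ⟨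
  ∑[ c < n ] ((q^ (9 + 3 * c) · Z c) /[1-q^1+ k ]) n   ≡⟨ geom-∑ k n _ n ⟨
  (∑ˢ[ c < n ] (q^ (9 + 3 * c) · Z c) /[1-q^1+ k ]) n  ≡⟨ geom-local k n (topTriples-truncate Z n) ⟩
  (topTriples Z /[1-q^1+ k ]) n                        ∎
  where open ≡-Reasoning

topTriples-*[1+q+q²] : ∀ Z → topTriples (λ c → Z c *[1+q+q²]) ≗ topTriples Z *[1+q+q²]
topTriples-*[1+q+q²] Z n = begin
  ∑[ c < n ] (q^ (9 + 3 * c) · (Z c *[1+q+q²])) n
    ≡⟨ ∑-cong n (λ c _ → shift-*[1+q+q²] (9 + 3 * c) (Z c) n) ⟩
  ∑[ c < n ] ((q^ (9 + 3 * c) · Z c) *[1+q+q²]) n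
    ≡⟨ ∑-*[1+q+q²] n _ n ⟨
  (∑ˢ[ c < n ] (q^ (9 + 3 * c) · Z c) *[1+q+q²]) n
    ≡⟨ *[1+q+q²]-local n (topTriples-truncate Z n) ⟩
  (topTriples Z *[1+q+q²]) n ∎
  where open ≡-Reasoning

ones : Series
ones = one /[1-q^1+ 0 ]

ones-unfold : ∀ a n → (q^ a · ones) n ≡ (q^ a · one) n + (q^ (a + 1) · ones) n
ones-unfold a = shift-unfold 1 a (geom-fix 0 one)

-- The terms of distinctFrom2∞ with fewer than three parts.
boundary : Series
boundary = one ⊕ q^ 2 · ones ⊕ q^ 5 · (ones /[1-q^1+ 1 ])

distinctFrom2∞-split : distinctFrom2∞ ≗ boundary ⊕ topTriples distinctFrom2 /[1-q^1+ 0 ] /[1-q^1+ 1 ]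
distinctFrom2∞-split n = begin
  distinctFrom2 n n
    ≡⟨ productFrom2-expand distinctFrom2-product n n ⟩
  one n + ∑[ a < n ] (q^ (2 + a) · D a) n
    ≡⟨ cong (one n +_) (∑-cong n (λ a _ → cong (λ e → (q^ (2 + e) · D a) n) (sym (*-identityˡ a)))) ⟩
  one n + ∑[ a < n ] (q^ (2 + 1 * a) · D a) n
    ≡⟨ cong (one n +_) (∑-productFrom2 distinctFrom2-product 1 0 n) ⟩
  one n + (onePart + ∑[ b < n ] (q^ (5 + 2 * b) · (D b /[1-q^1+ 0 ])) n)
    ≡⟨ cong (λ z → one n + (onePart + z))
         (∑-productFrom2 (productFrom2-geom 0 distinctFrom2-product) 4 1 n) ⟩
  one n + (onePart + (twoParts + topTriples (λ c → D c /[1-q^1+ 0 ] /[1-q^1+ 1 ]) n))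
    ≡⟨ cong (λ z → one n + (onePart + (twoParts + z)))
         (trans (topTriples-geom 1 _ n) (geom-cong 1 (topTriples-geom 0 D) n)) ⟩
  one n + (onePart + (twoParts + (topTriples D /[1-q^1+ 0 ] /[1-q^1+ 1 ]) n))
    ≡⟨ trans (sym (+-assoc (one n) onePart _)) (sym (+-assoc (one n + onePart) twoParts _)) ⟩
  (boundary ⊕ topTriples D /[1-q^1+ 0 ] /[1-q^1+ 1 ]) n ∎
  where
  open ≡-Reasoning
  D = distinctFrom2
  onePart = (q^ 2 · ones) n
  twoParts = (q^ 5 · (ones /[1-q^1+ 1 ])) n

exceptional : Series
exceptional = one ⊕ q^ 5 · one ⊕ q^ 7 · one

exceptional/[1-q³] : exceptional /[1-q^1+ 2 ] ≗ one ⊕ q^ 3 · one ⊕ q^ 5 · ones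
exceptional/[1-q³] n = sym (geom-unique 2 fix n)
  where
  R = one ⊕ q^ 3 · one ⊕ q^ 5 · ones
  rearrange : ∀ a b c d f g → (a + b) + (c + (d + (f + g))) ≡ ((a + c) + f) + ((b + d) + g)
  rearrange = solve-∀
  fix : R ≗ exceptional ⊕ q^ 3 · R
  fix n = begin
    (one n + e 3) + (q^ 5 · ones) n
      ≡⟨ cong ((one n + e 3) +_) (trans (ones-unfold 5 n) (cong (e 5 +_)
           (trans (ones-unfold 6 n) (cong (e 6 +_) (ones-unfold 7 n))))) ⟩
    (one n + e 3) + (e 5 + (e 6 + (e 7 + (q^ 8 · ones) n)))
      ≡⟨ rearrange (one n) (e 3) (e 5) (e 6) (e 7) _ ⟩
    ((one n + e 5) + e 7) + ((e 3 + e 6) + (q^ 8 · ones) n)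
      ≡⟨ cong (λ z → exceptional n + (z + (q^ 8 · ones) n)) (shift-unfold 3 3 (λ _ → refl) n) ⟨
    exceptional n + ((q^ 3 · (one ⊕ q^ 3 · one)) n + (q^ 8 · ones) n)
      ≡⟨ cong (exceptional n +_) (shift-unfold 5 3 (λ _ → refl) n) ⟨
    exceptional n + (q^ 3 · R) n ∎
    where
    open ≡-Reasoning
    e : ℕ → ℕ
    e a = (q^ a · one) n

boundary-fix : boundary ≗ exceptional /[1-q^1+ 2 ] ⊕ q^ 2 · boundary
boundary-fix n = begin
  (one n + o 2) + g 5
    ≡⟨ cong₂ (λ u v → (one n + u) + v) (trans (ones-unfold 2 n) (cong (e 2 +_) (ones-unfold 3 n)))
         (shift-unfold 2 5 (geom-fix 1 ones) n) ⟩
  (one n + (e 2 + (e 3 + o 4))) + (o 5 + g 7)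
    ≡⟨ rearrange (one n) (e 2) (e 3) (o 4) (o 5) (g 7) ⟩
  ((one n + e 3) + o 5) + ((e 2 + o 4) + g 7)
    ≡⟨ cong₂ _+_ (exceptional/[1-q³] n) (cong (_+ g 7) (shift-unfold 2 2 (λ _ → refl) n)) ⟨
  (exceptional /[1-q^1+ 2 ]) n + ((q^ 2 · (one ⊕ q^ 2 · ones)) n + g 7)
    ≡⟨ cong ((exceptional /[1-q^1+ 2 ]) n +_) (shift-unfold 5 2 (λ _ → refl) n) ⟨
  (exceptional /[1-q^1+ 2 ]) n + (q^ 2 · boundary) n ∎
  where
  open ≡-Reasoning
  e o g : ℕ → ℕ
  e a = (q^ a · one) n
  o a = (q^ a · ones) n
  g a = (q^ a · (ones /[1-q^1+ 1 ])) n
  rearrange : ∀ a b c d f h → (a + (b + (c + d))) + (f + h) ≡ ((a + c) + f) + ((b + d) + h)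
  rearrange = solve-∀

boundary*[1+q] : boundary *[1+q^ 1 ] ≗ exceptional /[1-q^1+ 2 ] /[1-q^1+ 0 ]
boundary*[1+q] = geom-unique 0 λ n → begin
  boundary n + (q^ 1 · boundary) n                  ≡⟨ cong (_+ (q^ 1 · boundary) n) (boundary-fix n) ⟩
  (R n + (q^ 2 · boundary) n) + (q^ 1 · boundary) n ≡⟨ +-assoc (R n) _ _ ⟩
  R n + ((q^ 2 · boundary) n + (q^ 1 · boundary) n) ≡⟨ cong (R n +_) (+-comm ((q^ 2 · boundary) n) _) ⟩
  R n + ((q^ 1 · boundary) n + (q^ 2 · boundary) n) ≡⟨ cong (R n +_) (shift-unfold 1 1 (λ _ → refl) n) ⟨
  R n + (q^ 1 · (boundary ⊕ q^ 1 · boundary)) n     ∎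
  where
  open ≡-Reasoning
  R = exceptional /[1-q^1+ 2 ]

partsIn : (ℕ → Bool) → ℕ → Series
partsIn S zero = one
partsIn S (suc k) = if S (suc k) then partsIn S k /[1-q^1+ k ] else partsIn S k

partsIn-allowed : ∀ S k → S (suc k) ≡ true → partsIn S (suc k) ≡ partsIn S k /[1-q^1+ k ]
partsIn-allowed S k allowed rewrite allowed = refl

partsIn-excluded : ∀ S k → S (suc k) ≡ false → partsIn S (suc k) ≡ partsIn S k
partsIn-excluded S k excluded rewrite excluded = refl

partsIn-stable : ∀ S k j i → i ≤ k → partsIn S (k + j) i ≡ partsIn S k i
partsIn-stable S k zero i _ = cong (λ m → partsIn S m i) (+-identityʳ k)
partsIn-stable S k (suc j) i i≤k rewrite +-suc k j with S (suc (k + j))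
... | true = trans (geom-small (k + j) _ i (≤-trans i≤k (m≤m+n k j))) (partsIn-stable S k j i i≤k)
... | false = partsIn-stable S k j i i≤k

partsIn-suc : ∀ S k n →
  partsIn S (suc k) n ≡ partsIn S k n + (if S (suc k) ∧ (suc k ≤ᵇ n) then partsIn S (suc k) (n ∸ suc k) else 0)
partsIn-suc S k n with S (suc k)
... | true = trans (geom-fix k _ n) (cong (partsIn S k n +_) (sym (if-≤ᵇ-shift (suc k) n _ refl)))
... | false = sym (+-identityʳ _)

partsIn-zero : ∀ S m → partsIn S m 0 ≡ 1
partsIn-zero S zero = refl
partsIn-zero S (suc k) with S (suc k)
... | true = trans (geom-small k _ 0 z≤n) (partsIn-zero S k)
... | false = partsIn-zero S k

oddAtLeast5 : ℕ → Bool
oddAtLeast5 x = isOdd x ∧ (5 ≤ᵇ x)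

isOdd-double : ∀ k → isOdd (k + k) ≡ false
isOdd-double k = cong (_≡ᵇ 1) (trans (cong (_% 2) (double k)) ([m+kn]%n≡m%n 0 k 2))
  where
  double : ∀ k → k + k ≡ 0 + k * 2
  double = solve-∀

isOdd-suc-double : ∀ k → isOdd (suc (k + k)) ≡ true
isOdd-suc-double k = cong (_≡ᵇ 1) (trans (cong (_% 2) (suc-double k)) ([m+kn]%n≡m%n 1 k 2))
  where
  suc-double : ∀ k → suc (k + k) ≡ 1 + k * 2
  suc-double = solve-∀

partsIn-oddAtLeast5-step : ∀ k → 2 ≤ k →
  partsIn oddAtLeast5 (suc (suc (k + k))) ≡ partsIn oddAtLeast5 (k + k) /[1-q^1+ k + k ]
partsIn-oddAtLeast5-step k 2≤k =
  trans (partsIn-excluded oddAtLeast5 (suc (k + k)) even) (partsIn-allowed oddAtLeast5 (k + k) odd≥5)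
  where
  even : oddAtLeast5 (suc (suc (k + k))) ≡ false
  even = cong (_∧ (5 ≤ᵇ suc (suc (k + k))))
    (trans (cong (λ m → isOdd (suc m)) (sym (+-suc k k))) (isOdd-double (suc k)))
  odd≥5 : oddAtLeast5 (suc (k + k)) ≡ true
  odd≥5 = trans (cong (_∧ (5 ≤ᵇ suc (k + k))) (isOdd-suc-double k))
    (Equivalence.to T-≡ (≤⇒≤ᵇ (s≤s (+-mono-≤ 2≤k 2≤k))))

oddParts≗partsIn-oddAtLeast5 : ∀ m →
  oddParts (2 + m) ≗ partsIn oddAtLeast5 ((2 + m) + (2 + m)) /[1-q^1+ 2 ] /[1-q^1+ 0 ]
oddParts≗partsIn-oddAtLeast5 zero = geom-comm 2 0 one
oddParts≗partsIn-oddAtLeast5 (suc m) n = begin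
  (oddParts k /[1-q^1+ k + k ]) n                   ≡⟨ geom-cong (k + k) (oddParts≗partsIn-oddAtLeast5 m) n ⟩
  (P /[1-q^1+ 2 ] /[1-q^1+ 0 ] /[1-q^1+ k + k ]) n  ≡⟨ geom-comm (k + k) 0 _ n ⟩
  (P /[1-q^1+ 2 ] /[1-q^1+ k + k ] /[1-q^1+ 0 ]) n  ≡⟨ geom-cong 0 (geom-comm (k + k) 2 P) n ⟩
  (P /[1-q^1+ k + k ] /[1-q^1+ 2 ] /[1-q^1+ 0 ]) n
    ≡⟨ cong (λ X → (X /[1-q^1+ 2 ] /[1-q^1+ 0 ]) n) (partsIn-oddAtLeast5-step k (s≤s (s≤s z≤n))) ⟨
  (partsIn oddAtLeast5 (suc (suc (k + k))) /[1-q^1+ 2 ] /[1-q^1+ 0 ]) n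
    ≡⟨ cong (λ j → (partsIn oddAtLeast5 (suc j) /[1-q^1+ 2 ] /[1-q^1+ 0 ]) n) (+-suc k k) ⟨
  (partsIn oddAtLeast5 (suc k + suc k) /[1-q^1+ 2 ] /[1-q^1+ 0 ]) n ∎
  where
  open ≡-Reasoning
  k = 2 + m
  P = partsIn oddAtLeast5 (k + k)

firstFamily : Series
firstFamily n = partsIn oddAtLeast5 n n

secondFamily : Series
secondFamily = topTriples (λ c → distinctFrom2 c *[1+q+q²])

firstFamily/[1-q³]/[1-q] : firstFamily /[1-q^1+ 2 ] /[1-q^1+ 0 ] ≗ distinctFrom2∞ *[1+q^ 1 ]
firstFamily/[1-q³]/[1-q] n = begin
  (firstFamily /[1-q^1+ 2 ] /[1-q^1+ 0 ]) n
    ≡⟨ geom-local 0 n (λ i i≤n → geom-local 2 i (λ j j≤i → truncate j (≤-trans j≤i i≤n))) ⟩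
  (partsIn oddAtLeast5 M /[1-q^1+ 2 ] /[1-q^1+ 0 ]) n   ≡⟨ oddParts≗partsIn-oddAtLeast5 n n ⟨
  oddParts (2 + n) n                                      ≡⟨ euler (2 + n) n (m≤n+m n 2) ⟩
  distinctParts (2 + n) n                                 ≡⟨ distinctParts≗distinctFrom2*[1+q] (suc n) n ⟩
  (distinctFrom2 (suc n) *[1+q^ 1 ]) n                    ≡⟨ *[1+q^]-local 1 n (λ i → stable i ∘ m≤n⇒m≤1+n) ⟩
  (distinctFrom2∞ *[1+q^ 1 ]) n                            ∎
  where
  open ≡-Reasoning
  M = (2 + n) + (2 + n)
  truncate : ∀ j → j ≤ n → firstFamily j ≡ partsIn oddAtLeast5 M j
  truncate j j≤n = sym (trans (cong (λ m → partsIn oddAtLeast5 m j) (sym (m+[n∸m]≡n j≤M)))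
    (partsIn-stable oddAtLeast5 j (M ∸ j) j ≤-refl))
    where
    j≤M = ≤-trans j≤n (≤-trans (m≤n+m n 2) (m≤m+n (2 + n) (2 + n)))
  stable : ∀ i → i ≤ suc n → distinctFrom2 (suc n) i ≡ distinctFrom2∞ i
  stable i i≤1+n = trans (cong (λ m → distinctFrom2 m i) (sym (m+[n∸m]≡n i≤1+n)))
    (distinctFrom2-stable i (suc n ∸ i) i (m≤n+m (suc i) 1))

firstFamily≗exceptional⊕secondFamily : firstFamily ≗ exceptional ⊕ secondFamily
firstFamily≗exceptional⊕secondFamily = geom-injective 2 (geom-injective 0 λ n → begin
  (firstFamily /[1-q^1+ 2 ] /[1-q^1+ 0 ]) n
    ≡⟨ firstFamily/[1-q³]/[1-q] n ⟩
  (distinctFrom2∞ *[1+q^ 1 ]) n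
    ≡⟨ *[1+q^]-cong 1 distinctFrom2∞-split n ⟩
  ((boundary ⊕ Triples /[1-q^1+ 0 ] /[1-q^1+ 1 ]) *[1+q^ 1 ]) n
    ≡⟨ *[1+q^]-⊕ 1 boundary _ n ⟩
  (boundary *[1+q^ 1 ]) n + (Triples /[1-q^1+ 0 ] /[1-q^1+ 1 ] *[1+q^ 1 ]) n
    ≡⟨ cong₂ _+_ (boundary*[1+q] n) (sym (geom-*[1+q^] 1 1 (Triples /[1-q^1+ 0 ]) n)) ⟩
  (E /[1-q^1+ 2 ] /[1-q^1+ 0 ]) n + (Triples /[1-q^1+ 0 ] *[1+q^ 1 ] /[1-q^1+ 1 ]) n
    ≡⟨ cong ((E /[1-q^1+ 2 ] /[1-q^1+ 0 ]) n +_) ([1+q^m]/[1-q^2m] 0 (Triples /[1-q^1+ 0 ]) n) ⟩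
  (E /[1-q^1+ 2 ] /[1-q^1+ 0 ]) n + (Triples /[1-q^1+ 0 ] /[1-q^1+ 0 ]) n
    ≡⟨ cong ((E /[1-q^1+ 2 ] /[1-q^1+ 0 ]) n +_) (geom-cong 0 Triples/[1-q]≗secondFamily/[1-q³] n) ⟩
  (E /[1-q^1+ 2 ] /[1-q^1+ 0 ]) n + (secondFamily /[1-q^1+ 2 ] /[1-q^1+ 0 ]) n
    ≡⟨ trans (geom-cong 0 (geom-⊕ 2 E secondFamily) n) (geom-⊕ 0 _ _ n) ⟨
  ((E ⊕ secondFamily) /[1-q^1+ 2 ] /[1-q^1+ 0 ]) n ∎)
  where
  open ≡-Reasoning
  E = exceptional
  Triples = topTriples distinctFrom2
  Triples/[1-q]≗secondFamily/[1-q³] : Triples /[1-q^1+ 0 ] ≗ secondFamily /[1-q^1+ 2 ]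
  Triples/[1-q]≗secondFamily/[1-q³] i = trans (sym ([1+q+q²]/[1-q³] Triples i))
    (geom-cong 2 (λ j → sym (topTriples-*[1+q+q²] distinctFrom2 j)) i)

-- Enumerating the two families

irrelevant-⇔⇒↔ : ∀ {P Q : Set} → Irrelevant P → Irrelevant Q → P ⇔ Q → P ↔ Q
irrelevant-⇔⇒↔ P-irr Q-irr P⇔Q =
  mk↔ₛ′ (Equivalence.to P⇔Q) (Equivalence.from P⇔Q) (λ _ → Q-irr _ _) (λ _ → P-irr _ _)

module _ {A : Set} where

  ∃∈↔Fin-length : (xs : List A) → (∃ λ a → a ∈ xs) ↔ Fin (length xs)
  ∃∈↔Fin-length xs =
    mk↔ₛ′ (λ (_ , a∈xs) → index a∈xs) (λ i → lookup xs i , ∈-lookup i) index-∈-lookup lookup-index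
    where
    index-∈-lookup : ∀ {xs} i → index (∈-lookup {xs = xs} i) ≡ i
    index-∈-lookup {_ ∷ _} zero = refl
    index-∈-lookup {_ ∷ xs} (suc i) = cong suc (index-∈-lookup {xs} i)
    lookup-index : ∀ {xs} ((a , a∈xs) : ∃ λ a → a ∈ xs) →
                   (lookup xs (index a∈xs) , ∈-lookup (index a∈xs)) ≡ (a , a∈xs)
    lookup-index (_ , here refl) = refl
    lookup-index (_ , there a∈xs) = cong (λ (a , a∈) → a , there a∈) (lookup-index (_ , a∈xs))

  Σ↔Fin-length : ∀ {P : A → Set} (xs : List A) → Unique xs → Unary.Irrelevant P →
                 (∀ {a} → P a ⇔ a ∈ xs) → Σ A P ↔ Fin (length xs)
  Σ↔Fin-length xs unique P-irr P⇔∈ =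
    ∃∈↔Fin-length xs ↔-∘ Σ-↔ (↔-id A) (irrelevant-⇔⇒↔ P-irr (unique⇒irrelevant unique) P⇔∈)

  ↔Fin-≡ : ∀ {m n} → m ≡ n → A ↔ Fin m → A ↔ Fin n
  ↔Fin-≡ refl A↔Fin = A↔Fin

  when : Bool → List A → List A
  when b xs = if b then xs else []

  module _ {B : Set} {f : B → A} where

    ∈-++-when-map⁻ : ∀ b xs {ys v} → v ∈ xs ++ when b (map f ys) →
                     v ∈ xs ⊎ (T b × ∃ λ r → r ∈ ys × v ≡ f r)
    ∈-++-when-map⁻ b xs v∈ with ∈-++⁻ xs v∈
    ∈-++-when-map⁻ b     xs v∈ | inj₁ v∈xs = inj₁ v∈xs
    ∈-++-when-map⁻ true  xs v∈ | inj₂ v∈new = inj₂ (_ , ∈-map⁻ f v∈new)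

    ∈-++-when-map⁺ʳ : ∀ {b} xs {ys r} → T b → r ∈ ys → f r ∈ xs ++ when b (map f ys)
    ∈-++-when-map⁺ʳ {true} xs _ r∈ys = ∈-++⁺ʳ xs (∈-map⁺ f r∈ys)

    ++-when-map-unique : ∀ b {xs ys} → Unique xs → Unique ys → (∀ {r s} → f r ≡ f s → r ≡ s) →
                         (∀ {r} → r ∈ ys → f r ∉ xs) → Unique (xs ++ when b (map f ys))
    ++-when-map-unique false {xs} xs! _ _ _ = subst Unique (sym (++-identityʳ xs)) xs!
    ++-when-map-unique true xs! ys! f-inj fresh = Unique.++⁺ xs! (Unique.map⁺ f-inj ys!) disjoint
      where
      disjoint : ∀ {v} → v ∈ _ × v ∈ map f _ → ⊥
      disjoint (v∈xs , v∈new) with ∈-map⁻ f v∈new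
      ... | _ , r∈ys , refl = fresh r∈ys v∈xs

    length-++-when-map : ∀ b xs ys → length (xs ++ when b (map f ys)) ≡ length xs + (if b then length ys else 0)
    length-++-when-map true xs ys = trans (length-++ xs) (cong (length xs +_) (length-map f ys))
    length-++-when-map false xs ys = length-++ xs

∧-intro : ∀ {x y} → T x → T y → T (x ∧ y)
∧-intro p q = Equivalence.from T-∧ (p , q)

∧-elim : ∀ {x y} → T (x ∧ y) → T x × T y
∧-elim = Equivalence.to T-∧

HeadAtMost : ℕ → List ℕ → Set
HeadAtMost m [] = ⊤
HeadAtMost m (x ∷ _) = x ≤ m

headAtMost-weaken : ∀ {m m′} l → m ≤ m′ → HeadAtMost m l → HeadAtMost m′ l
headAtMost-weaken [] _ _ = tt
headAtMost-weaken (x ∷ _) m≤m′ x≤m = ≤-trans x≤m m≤m′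

nonIncreasing-∷⁺ : ∀ x r → HeadAtMost x r → T (nonIncreasing r) → T (nonIncreasing (x ∷ r))
nonIncreasing-∷⁺ x [] _ _ = tt
nonIncreasing-∷⁺ x (y ∷ r) y≤x ni = ∧-intro (≤⇒≤ᵇ y≤x) ni

nonIncreasing-∷⁻ : ∀ x r → T (nonIncreasing (x ∷ r)) → HeadAtMost x r × T (nonIncreasing r)
nonIncreasing-∷⁻ x [] _ = tt , tt
nonIncreasing-∷⁻ x (y ∷ r) ni = ≤ᵇ⇒≤ y x (proj₁ (∧-elim ni)) , proj₂ (∧-elim ni)

isPartitionOf⁺ : ∀ n l → T (nonIncreasing l) → T (allOf (1 ≤ᵇ_) l) → sum l ≡ n → T (isPartitionOf n l)
isPartitionOf⁺ n l ni pos sum≡n =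
  ∧-intro {nonIncreasing l} ni (∧-intro {allOf (1 ≤ᵇ_) l} pos (≡⇒≡ᵇ (sum l) n sum≡n))

isPartitionOf⁻ : ∀ n l → T (isPartitionOf n l) → T (nonIncreasing l) × T (allOf (1 ≤ᵇ_) l) × sum l ≡ n
isPartitionOf⁻ n l isPart =
  let (ni , pos∧sum) = ∧-elim {nonIncreasing l} isPart
      (pos , sum≡ᵇn) = ∧-elim {allOf (1 ≤ᵇ_) l} pos∧sum
  in ni , pos , ≡ᵇ⇒≡ (sum l) n sum≡ᵇn

headAtMost-sum : ∀ l → HeadAtMost (sum l) l
headAtMost-sum [] = tt
headAtMost-sum (x ∷ l) = m≤m+n x (sum l)

data Partition (S : ℕ → Bool) : ℕ → ℕ → List ℕ → Set where
  [] : ∀ {m} → Partition S m 0 []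
  cons : ∀ {m n x r} → T (S (suc x)) → suc x ≤ m → Partition S (suc x) n r →
         Partition S m (suc x + n) (suc x ∷ r)

-- Arguments: fuel (n ≤ fuel suffices), bound on the parts, total n.
partitionsInto : (ℕ → Bool) → ℕ → ℕ → ℕ → List (List ℕ)
partitionsInto S (suc f) (suc k) n = partitionsInto S (suc f) k n
  ++ when (S (suc k) ∧ (suc k ≤ᵇ n)) (map (suc k ∷_) (partitionsInto S f (suc k) (n ∸ suc k)))
partitionsInto S _ _ zero = [] ∷ []
partitionsInto S _ _ (suc n) = []

module _ (S : ℕ → Bool) where

  Partition-weaken : ∀ {m m′ n l} → m ≤ m′ → Partition S m n l → Partition S m′ n l
  Partition-weaken m≤m′ [] = []
  Partition-weaken m≤m′ (cons allowed x≤m p) = cons allowed (≤-trans x≤m m≤m′) p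

  Partition-head : ∀ {m n l} → Partition S m n l → HeadAtMost m l
  Partition-head [] = tt
  Partition-head (cons _ x≤m _) = x≤m

  []∈partitionsInto : ∀ f m → [] ∈ partitionsInto S f m 0
  []∈partitionsInto (suc f) (suc k) = ∈-++⁺ˡ ([]∈partitionsInto (suc f) k)
  []∈partitionsInto zero m = here refl
  []∈partitionsInto (suc f) zero = here refl

  partitionsInto-complete : ∀ f m {n l} → n ≤ f → Partition S m n l → l ∈ partitionsInto S f m n
  partitionsInto-complete f m _ [] = []∈partitionsInto f m
  partitionsInto-complete (suc f) (suc k) n≤f (cons {n = n′} {x} {r} allowed x<m p) with m≤n⇒m<n∨m≡n x<m
  ... | inj₁ x<k = ∈-++⁺ˡ (partitionsInto-complete (suc f) k n≤f (cons allowed (≤-pred x<k) p))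
  ... | inj₂ refl =
    ∈-++-when-map⁺ʳ (partitionsInto S (suc f) k _) (∧-intro allowed (≤⇒≤ᵇ (m≤m+n (suc k) n′)))
    (subst (λ n → r ∈ partitionsInto S f (suc k) n) (sym (m+n∸m≡n (suc k) n′))
      (partitionsInto-complete f (suc k) (≤-trans (m≤n+m n′ k) (≤-pred n≤f)) p))

  partitionsInto-sound : ∀ f m {n l} → l ∈ partitionsInto S f m n → Partition S m n l
  partitionsInto-sound (suc f) (suc k) {n} l∈
    with ∈-++-when-map⁻ (S (suc k) ∧ (suc k ≤ᵇ n)) (partitionsInto S (suc f) k n) l∈
  ... | inj₁ l∈old = Partition-weaken (n≤1+n k) (partitionsInto-sound (suc f) k l∈old)
  ... | inj₂ (allowed∧k<n , r , r∈ , refl) =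
    subst (λ n → Partition S (suc k) n (suc k ∷ r))
      (m+[n∸m]≡n (≤ᵇ⇒≤ (suc k) n (proj₂ (∧-elim allowed∧k<n))))
      (cons (proj₁ (∧-elim allowed∧k<n)) ≤-refl (partitionsInto-sound f (suc k) r∈))
  partitionsInto-sound zero m {zero} (here refl) = []
  partitionsInto-sound (suc f) zero {zero} (here refl) = []

  partitionsInto-unique : ∀ f m n → Unique (partitionsInto S f m n)
  partitionsInto-unique (suc f) (suc k) n = ++-when-map-unique (S (suc k) ∧ (suc k ≤ᵇ n))
    (partitionsInto-unique (suc f) k n) (partitionsInto-unique f (suc k) (n ∸ suc k)) ∷-injectiveʳ
    (λ _ old → <-irrefl refl (Partition-head (partitionsInto-sound (suc f) k old)))
  partitionsInto-unique zero m zero = [] ∷ []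
  partitionsInto-unique zero m (suc n) = []
  partitionsInto-unique (suc f) zero zero = [] ∷ []
  partitionsInto-unique (suc f) zero (suc n) = []

  length-partitionsInto : ∀ f m n → n ≤ f → length (partitionsInto S f m n) ≡ partsIn S m n
  length-partitionsInto (suc f) (suc k) n n≤f = begin
    length (partitionsInto S (suc f) (suc k) n)
      ≡⟨ length-++-when-map b old new ⟩
    length old + (if b then length new else 0)
      ≡⟨ cong₂ (λ a c → a + (if b then c else 0))
           (length-partitionsInto (suc f) k n n≤f)
           (length-partitionsInto f (suc k) (n ∸ suc k) (≤-trans (∸-monoˡ-≤ (suc k) n≤f) (m∸n≤m f k))) ⟩
    partsIn S k n + (if b then partsIn S (suc k) (n ∸ suc k) else 0)
      ≡⟨ partsIn-suc S k n ⟨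
    partsIn S (suc k) n ∎
    where
    open ≡-Reasoning
    b = S (suc k) ∧ (suc k ≤ᵇ n)
    old = partitionsInto S (suc f) k n
    new = partitionsInto S f (suc k) (n ∸ suc k)
  length-partitionsInto zero m zero _ = sym (partsIn-zero S m)
  length-partitionsInto (suc f) zero zero _ = refl
  length-partitionsInto (suc f) zero (suc n) _ = refl

  toPartition : ∀ m l → T (nonIncreasing l) → T (allOf (1 ≤ᵇ_) l) → T (allOf S l) → HeadAtMost m l →
                Partition S m (sum l) l
  toPartition m [] _ _ _ _ = []
  toPartition m (suc x ∷ r) ni pos allowed x≤m
    with ∧-elim {S (suc x)} allowed | nonIncreasing-∷⁻ (suc x) r ni
  ... | x-allowed , r-allowed | head≤x , r-nonIncreasing =
    cons x-allowed x≤m (toPartition (suc x) r r-nonIncreasing pos r-allowed head≤x)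

  Partition-nonIncreasing : ∀ {m n l} → Partition S m n l → T (nonIncreasing l)
  Partition-nonIncreasing [] = tt
  Partition-nonIncreasing (cons {r = r} _ _ p) = nonIncreasing-∷⁺ _ r (Partition-head p) (Partition-nonIncreasing p)

  Partition-positive : ∀ {m n l} → Partition S m n l → T (allOf (1 ≤ᵇ_) l)
  Partition-positive [] = tt
  Partition-positive (cons _ _ p) = Partition-positive p

  Partition-allowed : ∀ {m n l} → Partition S m n l → T (allOf S l)
  Partition-allowed [] = tt
  Partition-allowed (cons allowed _ p) = ∧-intro allowed (Partition-allowed p)

  Partition-sum : ∀ {m n l} → Partition S m n l → sum l ≡ n
  Partition-sum [] = refl
  Partition-sum (cons {x = x} _ _ p) = cong (suc x +_) (Partition-sum p)

  Partition⇔ : ∀ n l → Partition S n n l ⇔ T (isPartitionOf n l ∧ allOf S l)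
  Partition⇔ n l = mk⇔
    (λ p → ∧-intro {isPartitionOf n l}
             (isPartitionOf⁺ n l (Partition-nonIncreasing p) (Partition-positive p) (Partition-sum p))
             (Partition-allowed p))
    (λ t → let (isPart , allowed) = ∧-elim {isPartitionOf n l} t
               (ni , pos , sum≡n) = isPartitionOf⁻ n l isPart
           in subst (λ m → Partition S m m l) sum≡n (toPartition (sum l) l ni pos allowed (headAtMost-sum l)))

-- The parts below c + 4, c + 3, c + 2 in a partition of the second family.
data DistinctFrom2+Ones : ℕ → ℕ → List ℕ → Set where
  ones₀ : ∀ {c} → DistinctFrom2+Ones c 0 []
  ones₁ : ∀ {c} → DistinctFrom2+Ones c 1 (1 ∷ [])
  ones₂ : ∀ {c} → DistinctFrom2+Ones c 2 (1 ∷ 1 ∷ [])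
  part : ∀ {c s y r} → y < c → DistinctFrom2+Ones y s r → DistinctFrom2+Ones c (2 + y + s) (2 + y ∷ r)

onesUpTo2 : ℕ → List (List ℕ)
onesUpTo2 0 = [] ∷ []
onesUpTo2 1 = (1 ∷ []) ∷ []
onesUpTo2 2 = (1 ∷ 1 ∷ []) ∷ []
onesUpTo2 (suc (suc (suc s))) = []

distinctFrom2+ones : ℕ → ℕ → List (List ℕ)
distinctFrom2+ones zero s = onesUpTo2 s
distinctFrom2+ones (suc c) s = distinctFrom2+ones c s
  ++ when (2 + c ≤ᵇ s) (map (2 + c ∷_) (distinctFrom2+ones c (s ∸ (2 + c))))

DistinctFrom2+Ones-weaken : ∀ {c c′ s r} → c ≤ c′ → DistinctFrom2+Ones c s r → DistinctFrom2+Ones c′ s r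
DistinctFrom2+Ones-weaken c≤c′ ones₀ = ones₀
DistinctFrom2+Ones-weaken c≤c′ ones₁ = ones₁
DistinctFrom2+Ones-weaken c≤c′ ones₂ = ones₂
DistinctFrom2+Ones-weaken c≤c′ (part y<c p) = part (<-≤-trans y<c c≤c′) p

DistinctFrom2+Ones-head : ∀ {c s r} → DistinctFrom2+Ones c s r → HeadAtMost (suc c) r
DistinctFrom2+Ones-head ones₀ = tt
DistinctFrom2+Ones-head ones₁ = s≤s z≤n
DistinctFrom2+Ones-head ones₂ = s≤s z≤n
DistinctFrom2+Ones-head (part y<c _) = s≤s y<c

distinctFrom2+ones-complete : ∀ c {s r} → DistinctFrom2+Ones c s r → r ∈ distinctFrom2+ones c s
distinctFrom2+ones-complete zero ones₀ = here refl
distinctFrom2+ones-complete zero ones₁ = here refl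
distinctFrom2+ones-complete zero ones₂ = here refl
distinctFrom2+ones-complete (suc c) ones₀ = ∈-++⁺ˡ (distinctFrom2+ones-complete c ones₀)
distinctFrom2+ones-complete (suc c) ones₁ = ∈-++⁺ˡ (distinctFrom2+ones-complete c ones₁)
distinctFrom2+ones-complete (suc c) ones₂ = ∈-++⁺ˡ (distinctFrom2+ones-complete c ones₂)
distinctFrom2+ones-complete (suc c) (part {s = s} {y} {r} y<c p) with m≤n⇒m<n∨m≡n (≤-pred y<c)
... | inj₁ y<c′ = ∈-++⁺ˡ (distinctFrom2+ones-complete c (part y<c′ p))
... | inj₂ refl = ∈-++-when-map⁺ʳ (distinctFrom2+ones c _) (≤⇒≤ᵇ (m≤m+n (2 + c) s))
  (subst (λ s′ → r ∈ distinctFrom2+ones c s′) (sym (m+n∸m≡n (2 + c) s)) (distinctFrom2+ones-complete c p))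

distinctFrom2+ones-sound : ∀ c {s r} → r ∈ distinctFrom2+ones c s → DistinctFrom2+Ones c s r
distinctFrom2+ones-sound zero {0} (here refl) = ones₀
distinctFrom2+ones-sound zero {1} (here refl) = ones₁
distinctFrom2+ones-sound zero {2} (here refl) = ones₂
distinctFrom2+ones-sound (suc c) {s} r∈ with ∈-++-when-map⁻ (2 + c ≤ᵇ s) (distinctFrom2+ones c s) r∈
... | inj₁ r∈old = DistinctFrom2+Ones-weaken (n≤1+n c) (distinctFrom2+ones-sound c r∈old)
... | inj₂ (2+c≤s , r , r∈ , refl) = subst (λ s → DistinctFrom2+Ones (suc c) s (2 + c ∷ r))
  (m+[n∸m]≡n (≤ᵇ⇒≤ (2 + c) s 2+c≤s)) (part ≤-refl (distinctFrom2+ones-sound c r∈))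

distinctFrom2+ones-unique : ∀ c s → Unique (distinctFrom2+ones c s)
distinctFrom2+ones-unique zero 0 = [] ∷ []
distinctFrom2+ones-unique zero 1 = [] ∷ []
distinctFrom2+ones-unique zero 2 = [] ∷ []
distinctFrom2+ones-unique zero (suc (suc (suc s))) = []
distinctFrom2+ones-unique (suc c) s = ++-when-map-unique (2 + c ≤ᵇ s)
  (distinctFrom2+ones-unique c s) (distinctFrom2+ones-unique c (s ∸ (2 + c))) ∷-injectiveʳ
  (λ _ old → <-irrefl refl (DistinctFrom2+Ones-head (distinctFrom2+ones-sound c old)))

length-distinctFrom2+ones : ∀ c s → length (distinctFrom2+ones c s) ≡ (distinctFrom2 c *[1+q+q²]) s
length-distinctFrom2+ones zero 0 = refl
length-distinctFrom2+ones zero 1 = refl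
length-distinctFrom2+ones zero 2 = refl
length-distinctFrom2+ones zero (suc (suc (suc s))) = refl
length-distinctFrom2+ones (suc c) s = begin
  length (distinctFrom2+ones (suc c) s)
    ≡⟨ length-++-when-map (2 + c ≤ᵇ s) (distinctFrom2+ones c s) (distinctFrom2+ones c (s ∸ (2 + c))) ⟩
  length (distinctFrom2+ones c s) + (if 2 + c ≤ᵇ s then length (distinctFrom2+ones c (s ∸ (2 + c))) else 0)
    ≡⟨ cong₂ _+_ (length-distinctFrom2+ones c s)
         (if-≤ᵇ-shift (2 + c) s _ (length-distinctFrom2+ones c (s ∸ (2 + c)))) ⟩
  (distinctFrom2 c *[1+q+q²] *[1+q^ 2 + c ]) s
    ≡⟨ *[1+q+q²]-*[1+q^] (2 + c) (distinctFrom2 c) s ⟨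
  (distinctFrom2 (suc c) *[1+q+q²]) s ∎
  where open ≡-Reasoning

triple : ℕ → List ℕ → List ℕ
triple c r = 4 + c ∷ 3 + c ∷ 2 + c ∷ r

data SecondFamilyPartition : ℕ → List ℕ → Set where
  triple+rest : ∀ c {s r} → DistinctFrom2+Ones c s r → SecondFamilyPartition (9 + 3 * c + s) (triple c r)

secondPartitions : ℕ → ℕ → List (List ℕ)
secondPartitions zero n = []
secondPartitions (suc K) n = secondPartitions K n
  ++ when (9 + 3 * K ≤ᵇ n) (map (triple K) (distinctFrom2+ones K (n ∸ (9 + 3 * K))))

secondPartitions-complete : ∀ K c {s r} → c < K → DistinctFrom2+Ones c s r →
                            triple c r ∈ secondPartitions K (9 + 3 * c + s)
secondPartitions-complete (suc K) c {s} {r} c<K p with m≤n⇒m<n∨m≡n (≤-pred c<K)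
... | inj₁ c<K′ = ∈-++⁺ˡ (secondPartitions-complete K c c<K′ p)
... | inj₂ refl = ∈-++-when-map⁺ʳ (secondPartitions c _) (≤⇒≤ᵇ (m≤m+n (9 + 3 * c) s))
  (subst (λ s′ → r ∈ distinctFrom2+ones c s′) (sym (m+n∸m≡n (9 + 3 * c) s)) (distinctFrom2+ones-complete c p))

secondPartitions-sound : ∀ K {n l} → l ∈ secondPartitions K n →
                         SecondFamilyPartition n l × ∃[ c ] ∃[ r ] c < K × l ≡ triple c r
secondPartitions-sound (suc K) {n} l∈ with ∈-++-when-map⁻ (9 + 3 * K ≤ᵇ n) (secondPartitions K n) l∈
... | inj₁ l∈old = let (p , c , r , c<K , eq) = secondPartitions-sound K l∈old in p , c , r , m≤n⇒m≤1+n c<K , eq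
... | inj₂ (K≤n , r , r∈ , refl) =
  subst (λ n → SecondFamilyPartition n (triple K r)) (m+[n∸m]≡n (≤ᵇ⇒≤ (9 + 3 * K) n K≤n))
    (triple+rest K (distinctFrom2+ones-sound K r∈)) ,
  K , r , ≤-refl , refl

secondPartitions-unique : ∀ K n → Unique (secondPartitions K n)
secondPartitions-unique zero n = []
secondPartitions-unique (suc K) n = ++-when-map-unique (9 + 3 * K ≤ᵇ n)
  (secondPartitions-unique K n) (distinctFrom2+ones-unique K _) (∷-injectiveʳ ∘ ∷-injectiveʳ ∘ ∷-injectiveʳ)
  fresh
  where
  fresh : ∀ {r} → r ∈ distinctFrom2+ones K (n ∸ (9 + 3 * K)) → triple K r ∉ secondPartitions K n
  fresh _ old with secondPartitions-sound K old
  ... | _ , c , _ , c<K , eq = <-irrefl (sym (+-cancelˡ-≡ 4 _ _ (∷-injectiveˡ eq))) c<K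

length-secondPartitions : ∀ K n →
  length (secondPartitions K n) ≡ ∑[ c < K ] (q^ (9 + 3 * c) · (distinctFrom2 c *[1+q+q²])) n
length-secondPartitions zero n = refl
length-secondPartitions (suc K) n = begin
  length (secondPartitions (suc K) n)
    ≡⟨ length-++-when-map (9 + 3 * K ≤ᵇ n) (secondPartitions K n) (distinctFrom2+ones K (n ∸ (9 + 3 * K))) ⟩
  length (secondPartitions K n) + (if 9 + 3 * K ≤ᵇ n then length (distinctFrom2+ones K (n ∸ (9 + 3 * K))) else 0)
    ≡⟨ cong₂ _+_ (length-secondPartitions K n)
         (if-≤ᵇ-shift (9 + 3 * K) n _ (length-distinctFrom2+ones K (n ∸ (9 + 3 * K)))) ⟩
  ∑[ c < suc K ] (q^ (9 + 3 * c) · (distinctFrom2 c *[1+q+q²])) n ∎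
  where open ≡-Reasoning

atLeast2 isOne : ℕ → Bool
atLeast2 x = 2 ≤ᵇ x
isOne x = x ≡ᵇ 1

DistinctFrom2+Ones-nonIncreasing : ∀ {c s r} → DistinctFrom2+Ones c s r → T (nonIncreasing r)
DistinctFrom2+Ones-nonIncreasing ones₀ = tt
DistinctFrom2+Ones-nonIncreasing ones₁ = tt
DistinctFrom2+Ones-nonIncreasing ones₂ = tt
DistinctFrom2+Ones-nonIncreasing (part {r = r} _ p) = nonIncreasing-∷⁺ _ r
  (headAtMost-weaken r (n≤1+n _) (DistinctFrom2+Ones-head p)) (DistinctFrom2+Ones-nonIncreasing p)

DistinctFrom2+Ones-positive : ∀ {c s r} → DistinctFrom2+Ones c s r → T (allOf (1 ≤ᵇ_) r)
DistinctFrom2+Ones-positive ones₀ = tt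
DistinctFrom2+Ones-positive ones₁ = tt
DistinctFrom2+Ones-positive ones₂ = tt
DistinctFrom2+Ones-positive (part _ p) = DistinctFrom2+Ones-positive p

DistinctFrom2+Ones-sum : ∀ {c s r} → DistinctFrom2+Ones c s r → sum r ≡ s
DistinctFrom2+Ones-sum ones₀ = refl
DistinctFrom2+Ones-sum ones₁ = refl
DistinctFrom2+Ones-sum ones₂ = refl
DistinctFrom2+Ones-sum (part {y = y} _ p) = cong (2 + y +_) (DistinctFrom2+Ones-sum p)

DistinctFrom2+Ones-distinct : ∀ {c s r} → DistinctFrom2+Ones c s r → T (strictlyDecreasing (2 + c ∷ keep atLeast2 r))
DistinctFrom2+Ones-distinct ones₀ = tt
DistinctFrom2+Ones-distinct ones₁ = tt
DistinctFrom2+Ones-distinct ones₂ = tt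
DistinctFrom2+Ones-distinct (part y<c p) = ∧-intro (<⇒<ᵇ y<c) (DistinctFrom2+Ones-distinct p)

DistinctFrom2+Ones-ones : ∀ {c s r} → DistinctFrom2+Ones c s r → length (keep isOne r) ≤ 2
DistinctFrom2+Ones-ones ones₀ = z≤n
DistinctFrom2+Ones-ones ones₁ = s≤s z≤n
DistinctFrom2+Ones-ones ones₂ = s≤s (s≤s z≤n)
DistinctFrom2+Ones-ones (part _ p) = DistinctFrom2+Ones-ones p

toDistinctFrom2+Ones : ∀ c r → T (nonIncreasing r) → T (allOf (1 ≤ᵇ_) r) →
  T (strictlyDecreasing (2 + c ∷ keep atLeast2 r)) → length (keep isOne r) ≤ 2 → DistinctFrom2+Ones c (sum r) r
toDistinctFrom2+Ones c [] _ _ _ _ = ones₀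
toDistinctFrom2+Ones c (1 ∷ []) _ _ _ _ = ones₁
toDistinctFrom2+Ones c (1 ∷ 1 ∷ []) _ _ _ _ = ones₂
toDistinctFrom2+Ones c (1 ∷ 1 ∷ 1 ∷ r) _ _ _ (s≤s (s≤s ()))
toDistinctFrom2+Ones c (suc (suc y) ∷ r) ni pos sd ones =
  part (≤-pred (≤-pred (<ᵇ⇒< (2 + y) (2 + c) (proj₁ (∧-elim sd)))))
    (toDistinctFrom2+Ones y r (proj₂ (nonIncreasing-∷⁻ _ r ni)) pos (proj₂ (∧-elim sd)) ones)
toDistinctFrom2+Ones c (0 ∷ r) _ () _ _
toDistinctFrom2+Ones c (1 ∷ 0 ∷ r) _ () _ _
toDistinctFrom2+Ones c (1 ∷ 1 ∷ 0 ∷ r) _ () _ _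
toDistinctFrom2+Ones c (1 ∷ 1 ∷ suc (suc z) ∷ r) () _ _ _
toDistinctFrom2+Ones c (1 ∷ suc (suc y) ∷ r) () _ _ _

sum-triple : ∀ c t → 4 + c + (3 + c + (2 + c + t)) ≡ 9 + 3 * c + t
sum-triple = solve-∀

secondCondition⁺ : ∀ l → T (strictlyDecreasing (keep atLeast2 l)) → T (3 ≤ᵇ length (keep atLeast2 l)) →
  T (length (keep isOne l) ≤ᵇ 2) → T (threeLargestConsecutive l) → T (secondCondition l)
secondCondition⁺ l distinct three ones consecutive =
  ∧-intro {strictlyDecreasing (keep atLeast2 l)} distinct (∧-intro {3 ≤ᵇ length (keep atLeast2 l)} three
    (∧-intro {length (keep isOne l) ≤ᵇ 2} ones consecutive))

SecondFamilyPartition⇒secondCondition : ∀ {n l} → SecondFamilyPartition n l →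
                                        T (isPartitionOf n l ∧ secondCondition l)
SecondFamilyPartition⇒secondCondition (triple+rest c {s} {r} p) =
  ∧-intro {isPartitionOf (9 + 3 * c + s) (triple c r)}
  (isPartitionOf⁺ (9 + 3 * c + s) (triple c r) nonIncr (DistinctFrom2+Ones-positive p) sum≡)
  (secondCondition⁺ (triple c r) distinct tt (≤⇒≤ᵇ (DistinctFrom2+Ones-ones p))
    (∧-intro {4 + c ≡ᵇ 4 + c} (≡⇒≡ᵇ (4 + c) _ refl) (≡⇒≡ᵇ (3 + c) _ refl)))
  where
  nonIncr : T (nonIncreasing (triple c r))
  nonIncr = nonIncreasing-∷⁺ (4 + c) (3 + c ∷ 2 + c ∷ r) (n≤1+n _)
    (nonIncreasing-∷⁺ (3 + c) (2 + c ∷ r) (n≤1+n _)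
      (nonIncreasing-∷⁺ (2 + c) r (headAtMost-weaken r (n≤1+n _) (DistinctFrom2+Ones-head p))
        (DistinctFrom2+Ones-nonIncreasing p)))
  sum≡ : sum (triple c r) ≡ 9 + 3 * c + s
  sum≡ = trans (cong (λ t → 4 + c + (3 + c + (2 + c + t))) (DistinctFrom2+Ones-sum p)) (sum-triple c s)
  distinct : T (strictlyDecreasing (keep atLeast2 (triple c r)))
  distinct = ∧-intro {3 + c <ᵇ 4 + c} (<⇒<ᵇ {3 + c} ≤-refl)
    (∧-intro {2 + c <ᵇ 3 + c} (<⇒<ᵇ {2 + c} ≤-refl) (DistinctFrom2+Ones-distinct p))

keep-atLeast2-ones : ∀ r → T (nonIncreasing (1 ∷ r)) → T (allOf (1 ≤ᵇ_) r) → keep atLeast2 r ≡ []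
keep-atLeast2-ones [] _ _ = refl
keep-atLeast2-ones (1 ∷ r) ni pos = keep-atLeast2-ones r (proj₂ (nonIncreasing-∷⁻ 1 (1 ∷ r) ni)) pos
keep-atLeast2-ones (0 ∷ r) _ ()
keep-atLeast2-ones (suc (suc y) ∷ r) ()

fromSecondCondition : ∀ n l → T (isPartitionOf n l) → T (strictlyDecreasing (keep atLeast2 l)) →
  T (3 ≤ᵇ length (keep atLeast2 l)) → T (length (keep isOne l) ≤ᵇ 2) → T (threeLargestConsecutive l) →
  SecondFamilyPartition n l
fromSecondCondition n (a ∷ b ∷ c ∷ r) isPart distinct three ones consecutive
  with ∧-elim {a ≡ᵇ suc b} consecutive
... | a≡1+b , b≡1+c with ≡ᵇ⇒≡ a (suc b) a≡1+b | ≡ᵇ⇒≡ b (suc c) b≡1+c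
... | refl | refl = fromTriple c (isPartitionOf⁻ n (suc (suc c) ∷ suc c ∷ c ∷ r) isPart) distinct three ones
  where
  fromTriple : ∀ c → let l = 2 + c ∷ 1 + c ∷ c ∷ r in
    T (nonIncreasing l) × T (allOf (1 ≤ᵇ_) l) × sum l ≡ n → T (strictlyDecreasing (keep atLeast2 l)) →
    T (3 ≤ᵇ length (keep atLeast2 l)) → T (length (keep isOne l) ≤ᵇ 2) → SecondFamilyPartition n l
  -- The smallest of the three is at least 2: 0 is not a part, and after 3, 2, 1 only 1s follow.
  fromTriple 0 (_ , () , _) _ _ _
  fromTriple 1 (ni , pos , _) _ three _ =
    ⊥-elim (subst (λ ks → T (3 ≤ᵇ 2 + length ks)) (keep-atLeast2-ones r ni-r pos) three)
    where
    ni-r = proj₂ (nonIncreasing-∷⁻ 2 (1 ∷ r) (proj₂ (nonIncreasing-∷⁻ 3 (2 ∷ 1 ∷ r) ni)))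
  fromTriple (suc (suc c)) (ni , pos , sum≡n) distinct _ ones =
    subst (λ n → SecondFamilyPartition n (triple c r)) (trans (sym (sum-triple c (sum r))) sum≡n)
      (triple+rest c (toDistinctFrom2+Ones c r ni-r pos distinct-r (≤ᵇ⇒≤ _ 2 ones)))
    where
    ni-r = proj₂ (nonIncreasing-∷⁻ (2 + c) r (proj₂ (nonIncreasing-∷⁻ (3 + c) (2 + c ∷ r)
             (proj₂ (nonIncreasing-∷⁻ (4 + c) (3 + c ∷ 2 + c ∷ r) ni)))))
    distinct-r = proj₂ (∧-elim {2 + c <ᵇ 3 + c} (proj₂ (∧-elim {3 + c <ᵇ 4 + c} distinct)))
fromSecondCondition n [] _ _ _ _ ()
fromSecondCondition n (_ ∷ []) _ _ _ _ ()
fromSecondCondition n (_ ∷ _ ∷ []) _ _ _ _ ()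

SecondFamilyPartition⇔ : ∀ n l → SecondFamilyPartition n l ⇔ T (isPartitionOf n l ∧ secondCondition l)
SecondFamilyPartition⇔ n l = mk⇔ SecondFamilyPartition⇒secondCondition λ t →
  let (isPart , cond) = ∧-elim {isPartitionOf n l} t
      (distinct , cond₁) = ∧-elim {strictlyDecreasing (keep atLeast2 l)} cond
      (three , cond₂) = ∧-elim {3 ≤ᵇ length (keep atLeast2 l)} cond₁
      (ones , consecutive) = ∧-elim {length (keep isOne l) ≤ᵇ 2} cond₂
  in fromSecondCondition n l isPart distinct three ones consecutive

firstFamily↔Fin : ∀ n → Σ (List ℕ) (λ l → T (isPartitionOf n l ∧ oddPartsAtLeast5 l)) ↔ Fin (firstFamily n)
firstFamily↔Fin n = ↔Fin-≡ (length-partitionsInto oddAtLeast5 n n n ≤-refl)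
  (Σ↔Fin-length (partitionsInto oddAtLeast5 n n n) (partitionsInto-unique oddAtLeast5 n n n) T-irrelevant
    (mk⇔ (partitionsInto-complete oddAtLeast5 n n ≤-refl) (partitionsInto-sound oddAtLeast5 n n)
      ⇔-∘ ⇔-sym (Partition⇔ oddAtLeast5 n _)))

secondFamily↔Fin : ∀ n → Σ (List ℕ) (λ l → T (isPartitionOf n l ∧ secondCondition l)) ↔ Fin (secondFamily n)
secondFamily↔Fin n = ↔Fin-≡ (length-secondPartitions n n)
  (Σ↔Fin-length (secondPartitions n n) (secondPartitions-unique n n) T-irrelevant
    (mk⇔ complete (λ l∈ → proj₁ (secondPartitions-sound n l∈)) ⇔-∘ ⇔-sym (SecondFamilyPartition⇔ n _)))
  where
  complete : ∀ {l} → SecondFamilyPartition n l → l ∈ secondPartitions n n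
  complete (triple+rest c {s} p) = secondPartitions-complete (9 + 3 * c + s) c c<n p
    where
    c<n = s≤s (≤-trans (m≤n*m c 3) (≤-trans (m≤n+m (3 * c) 8) (m≤m+n (8 + 3 * c) s)))

firstFamily≡secondFamily : ∀ n → 9 ≤ n → firstFamily n ≡ secondFamily n
firstFamily≡secondFamily n 9≤n = begin
  firstFamily n                    ≡⟨ firstFamily≗exceptional⊕secondFamily n ⟩
  exceptional n + secondFamily n   ≡⟨ cong (λ m → exceptional m + secondFamily n) (m+[n∸m]≡n 8≤n) ⟨
  exceptional (8 + (n ∸ 8)) + secondFamily n ≡⟨⟩
  secondFamily n ∎
  where
  open ≡-Reasoning
  8≤n = ≤-trans (n≤1+n 8) 9≤n

proposition2p1 : (n : ℕ) → 9 ≤ n →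
    (Σ (List ℕ) (λ l → T (isPartitionOf n l ∧ oddPartsAtLeast5 l)))
      ↔ (Σ (List ℕ) (λ l → T (isPartitionOf n l ∧ secondCondition l)))
proposition2p1 n 9≤n =
  ↔-sym (secondFamily↔Fin n) ↔-∘ ↔Fin-≡ (firstFamily≡secondFamily n 9≤n) (firstFamily↔Fin n)
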